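{- Let $f(x),g(x)\in\mathbb{Z}[x]$ be polynomials of positive degree having no common complex root. If $\gcd(L(f),L(g))=1$, then $B(f,g)$, $r(f,g)$ and $R(f,g)$ have the same prime factors.
   Context: $L(h)$ denotes the leading coefficient of $h\in\mathbb{Z}[x]$. There are unique $p,q\in\mathbb{Q}[x]$ with $pf+qg=1$, $\deg p<\deg g$, $\deg q<\deg f$; $B(f,g)$ is the least common multiple of the denominators (in lowest terms) of all coefficients of these $p$ and $q$. $r(f,g)$ is the smallest positive integer in $\{p(x)f(x)+q(x)g(x): p,q\in\mathbb{Z}[x]\}$. $R(f,g)=|\mathrm{Res}(f,g)|$, the absolute value of the resultant. -}

module Defs where

open import Data.Nat as ℕ using (ℕ; zero; suc)
open import Data.Nat.LCM using (lcm)
open import Data.Integer as ℤ using (ℤ; +_)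
open import Data.Rational as ℚ using (ℚ)
open import Data.Fin using (Fin; zero; suc; toℕ; punchIn; _≤?_; _-_)
open import Data.Fin as F using ()
open import Data.List using (List; []; _∷_; map; foldr; length; _∷ʳ_; _++_)
open import Data.Product using (Σ; ∃; _×_; _,_)
open import Relation.Binary.PropositionalEquality using (_≡_; _≢_)
open import Relation.Nullary using (does)
open import Data.Bool using (if_then_else_)

-- Polynomials over a (raw) ring, as coefficient lists, lowest degree first.
-- Two coefficient lists represent the same polynomial iff all their
-- coefficients agree (trailing zeros are irrelevant).

module PolyOps {A : Set} (0# : A) (_+_ _*_ : A → A → A) where

  coeff : List A → ℕ → A
  coeff []       _       = 0#
  coeff (a ∷ p)  zero    = a
  coeff (a ∷ p)  (suc k) = coeff p k

  add : List A → List A → List A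
  add []      q       = q
  add p       []      = p
  add (a ∷ p) (b ∷ q) = (a + b) ∷ add p q

  mul : List A → List A → List A
  mul []      q = []
  mul (a ∷ p) q = add (map (a *_) q) (0# ∷ mul p q)

  _≈ₚ_ : List A → List A → Set
  p ≈ₚ q = ∀ k → coeff p k ≡ coeff q k

module Zp = PolyOps (+ 0) ℤ._+_ ℤ._*_
module Qp = PolyOps ℚ.0ℚ ℚ._+_ ℚ._*_

record ZPoly⁺ : Set where
  field
    lower   : List ℤ
    lead    : ℤ
    lead≢0  : lead ≢ + 0
    deg≥1   : 1 ℕ.≤ length lower

open ZPoly⁺ public

coeffs : ZPoly⁺ → List ℤ
coeffs f = lower f ∷ʳ lead f

deg : ZPoly⁺ → ℕ
deg f = length (lower f)

L : ZPoly⁺ → ℤ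
L f = lead f

toℚ : ℤ → ℚ
toℚ z = z ℚ./ 1

coeffsℚ : ZPoly⁺ → List ℚ
coeffsℚ f = map toℚ (coeffs f)

lcmDen : List ℚ → ℕ
lcmDen xs = foldr (λ x acc → lcm (ℚ.denominatorℕ x) acc) 1 xs

-- p, q (given as coefficient vectors of length deg g and deg f, i.e.
-- deg p < deg g and deg q < deg f) satisfy  p f + q g = 1  in ℚ[x].
IsBezoutℚ : (f g : ZPoly⁺) → List ℚ → List ℚ → Set
IsBezoutℚ f g p q =
  length p ≡ deg g × length q ≡ deg f ×
  Qp._≈ₚ_ (Qp.add (Qp.mul p (coeffsℚ f)) (Qp.mul q (coeffsℚ g))) (ℚ.1ℚ ∷ [])

B : List ℚ → List ℚ → ℕ
B p q = lcmDen (p ++ q)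

-- f, g have no common complex root  ⇔  f, g coprime in ℚ[x],
-- i.e. there are p, q ∈ ℚ[x] with p f + q g = 1.
CoprimeInℚ[x] : ZPoly⁺ → ZPoly⁺ → Set
CoprimeInℚ[x] f g = Σ (List ℚ) λ p → Σ (List ℚ) λ q →
  Qp._≈ₚ_ (Qp.add (Qp.mul p (coeffsℚ f)) (Qp.mul q (coeffsℚ g))) (ℚ.1ℚ ∷ [])

InIdeal : ZPoly⁺ → ZPoly⁺ → ℕ → Set
InIdeal f g n = Σ (List ℤ) λ p → Σ (List ℤ) λ q →
  Zp._≈ₚ_ (Zp.add (Zp.mul p (coeffs f)) (Zp.mul q (coeffs g))) ((+ n) ∷ [])

IsR : ZPoly⁺ → ZPoly⁺ → ℕ → Set
IsR f g r = 1 ℕ.≤ r × InIdeal f g r × (∀ s → 1 ℕ.≤ s → InIdeal f g s → r ℕ.≤ s)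

sumℤ : ∀ {n} → (Fin n → ℤ) → ℤ
sumℤ {zero}  h = + 0
sumℤ {suc n} h = h zero ℤ.+ sumℤ (λ i → h (suc i))

det : ∀ {n} → (Fin n → Fin n → ℤ) → ℤ
det {zero}  M = + 1
det {suc n} M = sumℤ λ j →
  ((ℤ.- (+ 1)) ℤ.^ toℕ j) ℤ.* (M zero j ℤ.* det (λ r c → M (suc r) (punchIn j c)))

-- Sylvester matrix of f (degree m) and g (degree n), size (n+m)×(n+m):
-- row i < n holds the coefficients of x^i f, row n+i' holds those of x^i' g
-- (columns indexed by powers of x; this differs from the textbook layout
-- only by a permutation of columns, hence only up to sign).
sylvester : (f g : ZPoly⁺) → Fin (deg g ℕ.+ deg f) → Fin (deg g ℕ.+ deg f) → ℤ
sylvester f g i j with toℕ i ℕ.<? deg g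
... | Relation.Nullary.yes _ =
  if does (toℕ i ℕ.≤? toℕ j) then Zp.coeff (coeffs f) (toℕ j ℕ.∸ toℕ i) else + 0
... | Relation.Nullary.no _ =
  let i' = toℕ i ℕ.∸ deg g in
  if does (i' ℕ.≤? toℕ j) then Zp.coeff (coeffs g) (toℕ j ℕ.∸ i') else + 0

Res : ZPoly⁺ → ZPoly⁺ → ℤ
Res f g = det (sylvester f g)

R : ZPoly⁺ → ZPoly⁺ → ℕ
R f g = ℤ.∣ Res f g ∣

{-# OPTIONS --safe #-}

-- Let S be the Sylvester matrix, so R = |det S|, and let r ℤ = (f, g) ∩ ℤ.  Expanding det S
-- by cofactors writes Res = W₁ f + W₂ g with integer W₁, W₂, so r ∣ R; clearing
-- denominators in p f + q g = 1 shows B ∈ (f, g), so r ∣ B.  Low-degree syzygies of (f, g)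
-- vanish, so comparing the two representations gives Res p = W₁ and Res q = W₂, whence
-- B ∣ R.  Finally, if a prime ℓ divides R, then S is singular modulo ℓ and has a nonzero
-- left kernel vector, i.e. U f + V g ≡ 0 with deg U < deg g, deg V < deg f, not both zero
-- modulo ℓ; as ℓ misses one leading coefficient, the same syzygy argument makes this
-- impossible unless ℓ ∣ r.  Hence ℓ ∣ B ⇒ ℓ ∣ R ⇒ ℓ ∣ r, and r divides both B and R.

module Submission where

open import Defs
open import Data.Nat using (ℕ)
open import Data.Nat.GCD using (gcd)
open import Data.Nat.Divisibility using (_∣_)
open import Data.Nat.Primality using (Prime)
open import Data.Integer using (∣_∣)
open import Data.Rational using (ℚ)
open import Data.List using (List)
open import Data.Product using (_×_)
open import Function.Bundles using (_⇔_)
open import Relation.Binary.PropositionalEquality using (_≡_)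
open import Algebra.Bundles.Raw using (RawRing)
open import Algebra.Structures using (IsCommutativeRing)
open import Data.Integer using (ℤ)
open import Level using (0ℓ)
open import Data.Nat.Divisibility using (_∣?_; ∣-trans)
open import Data.Nat.GCD using (gcd-greatest)
open import Data.Product using (_,_; proj₁; proj₂)
open import Data.Sum using (_⊎_; inj₁; inj₂)
open import Function.Bundles using (mk⇔)
open import Relation.Binary.PropositionalEquality using (subst)
open import Relation.Nullary using (yes; no; ¬_)

module Polynomial (R : RawRing 0ℓ 0ℓ)
  (isCommutativeRing : IsCommutativeRing _≡_ (RawRing._+_ R) (RawRing._*_ R) (RawRing.-_ R) (RawRing.0# R) (RawRing.1# R))
  where

  open RawRing R using (Carrier; _+_; _*_; -_; 0#; 1#)

  open import Algebra.Bundles using (CommutativeRing)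
  open import Data.Fin using (Fin; zero; suc; toℕ)
  open import Data.List using (List; []; _∷_; map; length; tabulate)
  import Data.List.Properties as ListP
  open import Data.Nat using (zero; suc; _≤_; s≤s)
  open import Function using (_∘_)
  open import Data.Product using (_,_)
  open import Relation.Binary.PropositionalEquality
  open ≡-Reasoning

  open IsCommutativeRing isCommutativeRing using
    (+-identityˡ; +-identityʳ; +-comm; +-assoc; -‿inverseˡ; zeroˡ; zeroʳ;
     *-comm; *-assoc; *-identityˡ; distribˡ; distribʳ)

  private
    coefficientRing : CommutativeRing 0ℓ 0ℓ
    coefficientRing = record { isCommutativeRing = isCommutativeRing }

  open import Algebra.Properties.CommutativeSemigroup
    (CommutativeRing.+-commutativeSemigroup coefficientRing) using (interchange; x∙yz≈y∙xz)
  open import Algebra.Properties.Group (CommutativeRing.+-group coefficientRing) using (ε⁻¹≈ε)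

  open PolyOps 0# _+_ _*_ public

  infixl 6 _+ₚ_
  infixl 7 _*ₚ_ _·ₚ_
  infix 8 -ₚ_

  _+ₚ_ _*ₚ_ : List Carrier → List Carrier → List Carrier
  _+ₚ_ = add
  _*ₚ_ = mul

  -ₚ_ : List Carrier → List Carrier
  -ₚ_ = map (λ x → - x)

  _·ₚ_ : Carrier → List Carrier → List Carrier
  a ·ₚ p = map (a *_) p

  C : Carrier → List Carrier
  C a = a ∷ []

  -- A record rather than the pointwise type _≈ₚ_, so that p and q can be inferred from a
  -- proof of p ≋ q; the ring solver relies on this.
  infix 4 _≋_
  record _≋_ (p q : List Carrier) : Set where
    constructor mk≋
    field coeffwise : p ≈ₚ q
  open _≋_ public

  ≋-refl : ∀ {p} → p ≋ p
  ≋-refl = mk≋ λ _ → refl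

  ≋-sym : ∀ {p q} → p ≋ q → q ≋ p
  ≋-sym e = mk≋ λ k → sym (coeffwise e k)

  ≋-trans : ∀ {p q s} → p ≋ q → q ≋ s → p ≋ s
  ≋-trans e e′ = mk≋ λ k → trans (coeffwise e k) (coeffwise e′ k)

  ∷-cong : ∀ {a b p q} → a ≡ b → p ≋ q → a ∷ p ≋ b ∷ q
  ∷-cong a≡b e = mk≋ λ { zero → a≡b ; (suc k) → coeffwise e k }

  0∷-≋[] : ∀ {p} → p ≋ [] → 0# ∷ p ≋ []
  0∷-≋[] e = mk≋ λ { zero → refl ; (suc k) → coeffwise e k }

  coeff-+ₚ : ∀ p q k → coeff (p +ₚ q) k ≡ coeff p k + coeff q k
  coeff-+ₚ []      q       k       = sym (+-identityˡ _)
  coeff-+ₚ (a ∷ p) []      k       = sym (+-identityʳ _)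
  coeff-+ₚ (a ∷ p) (b ∷ q) zero    = refl
  coeff-+ₚ (a ∷ p) (b ∷ q) (suc k) = coeff-+ₚ p q k

  coeff-map : ∀ (h : Carrier → Carrier) → h 0# ≡ 0# → ∀ p k → coeff (map h p) k ≡ h (coeff p k)
  coeff-map h h0 []      k       = sym h0
  coeff-map h h0 (a ∷ p) zero    = refl
  coeff-map h h0 (a ∷ p) (suc k) = coeff-map h h0 p k

  coeff-·ₚ : ∀ a p k → coeff (a ·ₚ p) k ≡ a * coeff p k
  coeff-·ₚ a = coeff-map (a *_) (zeroʳ a)

  coeff--ₚ : ∀ p k → coeff (-ₚ p) k ≡ - coeff p k
  coeff--ₚ = coeff-map (λ x → - x) ε⁻¹≈ε

  coeff-∷*ₚ : ∀ a p q k → coeff ((a ∷ p) *ₚ q) k ≡ a * coeff q k + coeff (0# ∷ p *ₚ q) k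
  coeff-∷*ₚ a p q k = trans (coeff-+ₚ (a ·ₚ q) (0# ∷ p *ₚ q) k) (cong (_+ _) (coeff-·ₚ a q k))

  coeff-C*ₚ : ∀ a p k → coeff (C a *ₚ p) k ≡ a * coeff p k
  coeff-C*ₚ a p zero    = trans (coeff-∷*ₚ a [] p zero) (+-identityʳ _)
  coeff-C*ₚ a p (suc k) = trans (coeff-∷*ₚ a [] p (suc k)) (+-identityʳ _)

  +ₚ-cong : ∀ {p p′ q q′} → p ≋ p′ → q ≋ q′ → p +ₚ q ≋ p′ +ₚ q′
  +ₚ-cong {p} {p′} {q} {q′} e e′ = mk≋ λ k → begin
    coeff (p +ₚ q) k            ≡⟨ coeff-+ₚ p q k ⟩
    coeff p k + coeff q k       ≡⟨ cong₂ _+_ (coeffwise e k) (coeffwise e′ k) ⟩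
    coeff p′ k + coeff q′ k     ≡⟨ coeff-+ₚ p′ q′ k ⟨
    coeff (p′ +ₚ q′) k          ∎

  +ₚ-comm : ∀ p q → p +ₚ q ≋ q +ₚ p
  +ₚ-comm p q = mk≋ λ k → begin
    coeff (p +ₚ q) k          ≡⟨ coeff-+ₚ p q k ⟩
    coeff p k + coeff q k     ≡⟨ +-comm _ _ ⟩
    coeff q k + coeff p k     ≡⟨ coeff-+ₚ q p k ⟨
    coeff (q +ₚ p) k          ∎

  +ₚ-assoc : ∀ p q s → p +ₚ q +ₚ s ≋ p +ₚ (q +ₚ s)
  +ₚ-assoc p q s = mk≋ λ k → begin
    coeff (p +ₚ q +ₚ s) k                   ≡⟨ coeff-+ₚ (p +ₚ q) s k ⟩
    coeff (p +ₚ q) k + coeff s k            ≡⟨ cong (_+ coeff s k) (coeff-+ₚ p q k) ⟩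
    coeff p k + coeff q k + coeff s k       ≡⟨ +-assoc _ _ _ ⟩
    coeff p k + (coeff q k + coeff s k)     ≡⟨ cong (coeff p k +_) (coeff-+ₚ q s k) ⟨
    coeff p k + coeff (q +ₚ s) k            ≡⟨ coeff-+ₚ p (q +ₚ s) k ⟨
    coeff (p +ₚ (q +ₚ s)) k                 ∎

  +ₚ-identityʳ : ∀ p → p +ₚ [] ≋ p
  +ₚ-identityʳ p = mk≋ λ k → trans (coeff-+ₚ p [] k) (+-identityʳ _)

  -ₚ-inverseˡ : ∀ p → -ₚ p +ₚ p ≋ []
  -ₚ-inverseˡ p = mk≋ λ k → begin
    coeff (-ₚ p +ₚ p) k           ≡⟨ coeff-+ₚ (-ₚ p) p k ⟩
    coeff (-ₚ p) k + coeff p k    ≡⟨ cong (_+ coeff p k) (coeff--ₚ p k) ⟩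
    - coeff p k + coeff p k       ≡⟨ -‿inverseˡ _ ⟩
    0#                            ∎

  -ₚ-cong : ∀ {p q} → p ≋ q → -ₚ p ≋ -ₚ q
  -ₚ-cong {p} {q} e = mk≋ λ k →
    trans (coeff--ₚ p k) (trans (cong (λ x → - x) (coeffwise e k)) (sym (coeff--ₚ q k)))

  *ₚ-zeroˡ-≋ : ∀ p q → p ≋ [] → p *ₚ q ≋ []
  *ₚ-zeroˡ-≋ []      q e = ≋-refl
  *ₚ-zeroˡ-≋ (a ∷ p) q e = mk≋ λ k → begin
    coeff ((a ∷ p) *ₚ q) k                  ≡⟨ coeff-∷*ₚ a p q k ⟩
    a * coeff q k + coeff (0# ∷ p *ₚ q) k   ≡⟨ cong₂ _+_ (cong (_* coeff q k) (coeffwise e zero)) (coeffwise tail≋ k) ⟩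
    0# * coeff q k + 0#                     ≡⟨ trans (+-identityʳ _) (zeroˡ _) ⟩
    0#                                      ∎
    where
    tail≋ : 0# ∷ p *ₚ q ≋ []
    tail≋ = 0∷-≋[] (*ₚ-zeroˡ-≋ p q (mk≋ λ k → coeffwise e (suc k)))

  *ₚ-congʳ : ∀ {p p′} q → p ≋ p′ → p *ₚ q ≋ p′ *ₚ q
  *ₚ-congʳ {[]}    {p′}     q e = ≋-sym (*ₚ-zeroˡ-≋ p′ q (≋-sym e))
  *ₚ-congʳ {p}     {[]}     q e = *ₚ-zeroˡ-≋ p q e
  *ₚ-congʳ {a ∷ p} {b ∷ p′} q e = mk≋ λ k → begin
    coeff ((a ∷ p) *ₚ q) k                    ≡⟨ coeff-∷*ₚ a p q k ⟩
    a * coeff q k + coeff (0# ∷ p *ₚ q) k     ≡⟨ cong₂ _+_ (cong (_* coeff q k) (coeffwise e zero)) (coeffwise tail≋ k) ⟩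
    b * coeff q k + coeff (0# ∷ p′ *ₚ q) k    ≡⟨ coeff-∷*ₚ b p′ q k ⟨
    coeff ((b ∷ p′) *ₚ q) k                   ∎
    where
    tail≋ : 0# ∷ p *ₚ q ≋ 0# ∷ p′ *ₚ q
    tail≋ = ∷-cong refl (*ₚ-congʳ {p} {p′} q (mk≋ λ k → coeffwise e (suc k)))

  *ₚ-zeroʳ : ∀ p → p *ₚ [] ≋ []
  *ₚ-zeroʳ []      = ≋-refl
  *ₚ-zeroʳ (a ∷ p) = 0∷-≋[] (*ₚ-zeroʳ p)

  *ₚ-∷ʳ : ∀ p b q → p *ₚ (b ∷ q) ≋ b ·ₚ p +ₚ (0# ∷ p *ₚ q)
  *ₚ-∷ʳ []      b q = ≋-sym (0∷-≋[] ≋-refl)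
  *ₚ-∷ʳ (a ∷ p) b q = mk≋ λ
    { zero    → trans (+-identityʳ _) (trans (*-comm a b) (sym (+-identityʳ _)))
    ; (suc k) → begin
        coeff ((a ∷ p) *ₚ (b ∷ q)) (suc k)
          ≡⟨ coeff-∷*ₚ a p (b ∷ q) (suc k) ⟩
        a * coeff q k + coeff (p *ₚ (b ∷ q)) k
          ≡⟨ cong (a * coeff q k +_) (coeffwise (*ₚ-∷ʳ p b q) k) ⟩
        a * coeff q k + coeff (b ·ₚ p +ₚ (0# ∷ p *ₚ q)) k
          ≡⟨ cong (a * coeff q k +_) (coeff-+ₚ (b ·ₚ p) _ k) ⟩
        a * coeff q k + (coeff (b ·ₚ p) k + coeff (0# ∷ p *ₚ q) k)
          ≡⟨ x∙yz≈y∙xz _ _ _ ⟩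
        coeff (b ·ₚ p) k + (a * coeff q k + coeff (0# ∷ p *ₚ q) k)
          ≡⟨ cong (coeff (b ·ₚ p) k +_) (coeff-∷*ₚ a p q k) ⟨
        coeff (b ·ₚ p) k + coeff ((a ∷ p) *ₚ q) k
          ≡⟨ coeff-+ₚ (b ·ₚ (a ∷ p)) (0# ∷ (a ∷ p) *ₚ q) (suc k) ⟨
        coeff (b ·ₚ (a ∷ p) +ₚ (0# ∷ (a ∷ p) *ₚ q)) (suc k) ∎ }

  *ₚ-comm : ∀ p q → p *ₚ q ≋ q *ₚ p
  *ₚ-comm []      q = ≋-sym (*ₚ-zeroʳ q)
  *ₚ-comm (a ∷ p) q =
    ≋-sym (≋-trans (*ₚ-∷ʳ q a p) (+ₚ-cong (≋-refl {a ·ₚ q}) (∷-cong refl (*ₚ-comm q p))))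

  *ₚ-congˡ : ∀ p {q q′} → q ≋ q′ → p *ₚ q ≋ p *ₚ q′
  *ₚ-congˡ p {q} {q′} e = ≋-trans (*ₚ-comm p q) (≋-trans (*ₚ-congʳ p e) (*ₚ-comm q′ p))

  *ₚ-distribʳ : ∀ q p p′ → (p +ₚ p′) *ₚ q ≋ p *ₚ q +ₚ p′ *ₚ q
  *ₚ-distribʳ q []      p′       = ≋-refl
  *ₚ-distribʳ q (a ∷ p) []       = ≋-sym (+ₚ-identityʳ _)
  *ₚ-distribʳ q (a ∷ p) (b ∷ p′) = mk≋ λ k → begin
    coeff (((a ∷ p) +ₚ (b ∷ p′)) *ₚ q) k
      ≡⟨ coeff-∷*ₚ (a + b) (p +ₚ p′) q k ⟩
    (a + b) * coeff q k + coeff (0# ∷ (p +ₚ p′) *ₚ q) k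
      ≡⟨ cong₂ _+_ (distribʳ _ a b) (coeffwise (∷-cong (sym (+-identityʳ 0#)) (*ₚ-distribʳ q p p′)) k) ⟩
    (a * coeff q k + b * coeff q k) + coeff ((0# ∷ p *ₚ q) +ₚ (0# ∷ p′ *ₚ q)) k
      ≡⟨ cong ((a * coeff q k + b * coeff q k) +_) (coeff-+ₚ (0# ∷ p *ₚ q) (0# ∷ p′ *ₚ q) k) ⟩
    (a * coeff q k + b * coeff q k) + (coeff (0# ∷ p *ₚ q) k + coeff (0# ∷ p′ *ₚ q) k)
      ≡⟨ interchange _ _ _ _ ⟩
    (a * coeff q k + coeff (0# ∷ p *ₚ q) k) + (b * coeff q k + coeff (0# ∷ p′ *ₚ q) k)
      ≡⟨ cong₂ _+_ (coeff-∷*ₚ a p q k) (coeff-∷*ₚ b p′ q k) ⟨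
    coeff ((a ∷ p) *ₚ q) k + coeff ((b ∷ p′) *ₚ q) k
      ≡⟨ coeff-+ₚ ((a ∷ p) *ₚ q) _ k ⟨
    coeff ((a ∷ p) *ₚ q +ₚ (b ∷ p′) *ₚ q) k ∎

  *ₚ-distribˡ : ∀ p q q′ → p *ₚ (q +ₚ q′) ≋ p *ₚ q +ₚ p *ₚ q′
  *ₚ-distribˡ p q q′ = ≋-trans (*ₚ-comm p _)
    (≋-trans (*ₚ-distribʳ p q q′) (+ₚ-cong (*ₚ-comm q p) (*ₚ-comm q′ p)))

  ·ₚ-*ₚ : ∀ a q s → (a ·ₚ q) *ₚ s ≋ a ·ₚ (q *ₚ s)
  ·ₚ-*ₚ a []      s = ≋-refl
  ·ₚ-*ₚ a (b ∷ q) s = mk≋ λ k → begin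
    coeff ((a ·ₚ (b ∷ q)) *ₚ s) k
      ≡⟨ coeff-∷*ₚ (a * b) (a ·ₚ q) s k ⟩
    a * b * coeff s k + coeff (0# ∷ (a ·ₚ q) *ₚ s) k
      ≡⟨ cong₂ _+_ (*-assoc a b _) (coeffwise (∷-cong (sym (zeroʳ a)) (·ₚ-*ₚ a q s)) k) ⟩
    a * (b * coeff s k) + coeff (a ·ₚ (0# ∷ q *ₚ s)) k
      ≡⟨ cong (a * (b * coeff s k) +_) (coeff-·ₚ a (0# ∷ q *ₚ s) k) ⟩
    a * (b * coeff s k) + a * coeff (0# ∷ q *ₚ s) k
      ≡⟨ distribˡ a _ _ ⟨
    a * (b * coeff s k + coeff (0# ∷ q *ₚ s) k)
      ≡⟨ cong (a *_) (coeff-∷*ₚ b q s k) ⟨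
    a * coeff ((b ∷ q) *ₚ s) k
      ≡⟨ coeff-·ₚ a ((b ∷ q) *ₚ s) k ⟨
    coeff (a ·ₚ ((b ∷ q) *ₚ s)) k ∎

  *ₚ-assoc : ∀ p q s → p *ₚ q *ₚ s ≋ p *ₚ (q *ₚ s)
  *ₚ-assoc []      q s = ≋-refl
  *ₚ-assoc (a ∷ p) q s = ≋-trans (*ₚ-distribʳ s (a ·ₚ q) (0# ∷ p *ₚ q))
    (+ₚ-cong (·ₚ-*ₚ a q s) (≋-trans (shift (p *ₚ q)) (∷-cong refl (*ₚ-assoc p q s))))
    where
    shift : ∀ t → (0# ∷ t) *ₚ s ≋ 0# ∷ t *ₚ s
    shift t = mk≋ λ k → trans (coeff-∷*ₚ 0# t s k) (trans (cong (_+ coeff (0# ∷ t *ₚ s) k) (zeroˡ _)) (+-identityˡ _))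

  *ₚ-identityˡ : ∀ p → C 1# *ₚ p ≋ p
  *ₚ-identityˡ p = mk≋ λ k → trans (coeff-C*ₚ 1# p k) (*-identityˡ _)

  *ₚ-identityʳ : ∀ p → p *ₚ C 1# ≋ p
  *ₚ-identityʳ p = ≋-trans (*ₚ-comm p (C 1#)) (*ₚ-identityˡ p)

  polynomialRing : CommutativeRing 0ℓ 0ℓ
  polynomialRing = record
    { Carrier = List Carrier ; _≈_ = _≋_ ; _+_ = _+ₚ_ ; _*_ = _*ₚ_ ; -_ = -ₚ_ ; 0# = [] ; 1# = C 1#
    ; isCommutativeRing = record
      { isRing = record
        { +-isAbelianGroup = record
          { isGroup = record
            { isMonoid = record
              { isSemigroup = record
                { isMagma = record
                  { isEquivalence = record { refl = ≋-refl ; sym = ≋-sym ; trans = ≋-trans }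
                  ; ∙-cong = +ₚ-cong }
                ; assoc = +ₚ-assoc }
              ; identity = (λ _ → ≋-refl) , +ₚ-identityʳ }
            ; inverse = -ₚ-inverseˡ , (λ p → ≋-trans (+ₚ-comm p (-ₚ p)) (-ₚ-inverseˡ p))
            ; ⁻¹-cong = -ₚ-cong }
          ; comm = +ₚ-comm }
        ; *-cong = λ {p} {p′} {q} {q′} e e′ → ≋-trans (*ₚ-congʳ q e) (*ₚ-congˡ p′ e′)
        ; *-assoc = *ₚ-assoc
        ; *-identity = *ₚ-identityˡ , *ₚ-identityʳ
        ; distrib = *ₚ-distribˡ , *ₚ-distribʳ }
      ; *-comm = *ₚ-comm } }

  coeff-≥length : ∀ (xs : List Carrier) k → length xs ≤ k → coeff xs k ≡ 0#
  coeff-≥length []       k       _         = refl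
  coeff-≥length (x ∷ xs) (suc k) (s≤s le) = coeff-≥length xs k le

  coeff-tabulate : ∀ {n} (v : Fin n → Carrier) i → coeff (tabulate v) (toℕ i) ≡ v i
  coeff-tabulate v zero    = refl
  coeff-tabulate v (suc i) = coeff-tabulate (v ∘ suc) i

  coeff-tabulate-≥ : ∀ {n} (v : Fin n → Carrier) k → n ≤ k → coeff (tabulate v) k ≡ 0#
  coeff-tabulate-≥ v k n≤k = coeff-≥length (tabulate v) k (subst (_≤ k) (sym (ListP.length-tabulate v)) n≤k)

module IntegerPolynomial where

  open import Data.Integer as ℤ using (ℤ; +_)
  import Data.Integer.Properties as ℤP
  open import Data.List using (List; []; _∷_; length; _++_)
  import Data.List.Properties as ListP
  open import Data.Maybe using (Maybe; map)
  open import Data.Nat using (zero; suc; _<_; _≤_)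
  import Data.Nat.Properties as ℕP
  open import Relation.Binary.PropositionalEquality using (_≡_; refl; sym; trans; subst)
  open import Relation.Nullary.Decidable using (dec⇒maybe)
  open import Algebra.Solver.Ring.AlmostCommutativeRing
    using (fromCommutativeRing; _-Raw-AlmostCommutative⟶_)

  open Polynomial ℤ.+-*-rawRing ℤP.+-*-isCommutativeRing public

  C-homomorphism : ℤ.+-*-rawRing -Raw-AlmostCommutative⟶ fromCommutativeRing polynomialRing
  C-homomorphism = record
    { ⟦_⟧    = C
    ; +-homo = λ a b → ≋-refl
    ; *-homo = λ a b → mk≋ λ { zero → sym (ℤP.+-identityʳ _) ; (suc k) → refl }
    ; -‿homo = λ a → ≋-refl
    ; 0-homo = mk≋ λ { zero → refl ; (suc k) → refl }
    ; 1-homo = ≋-refl }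

  C-≟ : ∀ a b → Maybe (C a ≋ C b)
  C-≟ a b = map (λ { refl → ≋-refl }) (dec⇒maybe (a ℤ.≟ b))

  open import Algebra.Solver.Ring ℤ.+-*-rawRing (fromCommutativeRing polynomialRing) C-homomorphism C-≟

  infixl 6 _-ₚ_
  _-ₚ_ : List ℤ → List ℤ → List ℤ
  p -ₚ q = p +ₚ -ₚ q

  syzygy-identity : ∀ P Q F G u v →
    P *ₚ (u *ₚ F +ₚ v *ₚ G) ≋ (P *ₚ F +ₚ Q *ₚ G) *ₚ u -ₚ G *ₚ (Q *ₚ u -ₚ P *ₚ v)
  syzygy-identity = solve 6 (λ P Q F G u v →
    P :* (u :* F :+ v :* G) := (P :* F :+ Q :* G) :* u :- G :* (Q :* u :- P :* v)) ≋-refl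

  combination-identity : ∀ a b P₁ Q₁ P₂ Q₂ F G →
    (a *ₚ P₁ +ₚ b *ₚ P₂) *ₚ F +ₚ (a *ₚ Q₁ +ₚ b *ₚ Q₂) *ₚ G ≋
    a *ₚ (P₁ *ₚ F +ₚ Q₁ *ₚ G) +ₚ b *ₚ (P₂ *ₚ F +ₚ Q₂ *ₚ G)
  combination-identity = solve 8 (λ a b P₁ Q₁ P₂ Q₂ F G →
    (a :* P₁ :+ b :* P₂) :* F :+ (a :* Q₁ :+ b :* Q₂) :* G :=
    a :* (P₁ :* F :+ Q₁ :* G) :+ b :* (P₂ :* F :+ Q₂ :* G)) ≋-refl

  length-coeffs : ∀ h → length (coeffs h) ≡ suc (deg h)
  length-coeffs h = trans (ListP.length-++ (lower h)) (ℕP.+-comm (deg h) 1)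

  coeff-coeffs-deg : ∀ h → coeff (coeffs h) (deg h) ≡ lead h
  coeff-coeffs-deg h = go (lower h)
    where
    go : ∀ xs → coeff (xs ++ lead h ∷ []) (length xs) ≡ lead h
    go []       = refl
    go (x ∷ xs) = go xs

  coeff-coeffs-> : ∀ h k → deg h < k → coeff (coeffs h) k ≡ + 0
  coeff-coeffs-> h k deg<k = coeff-≥length (coeffs h) k (subst (_≤ k) (sym (length-coeffs h)) deg<k)

module PrimeIdeal where

  open import Data.Empty using (⊥-elim)
  open import Data.Integer as ℤ using (ℤ; +_; _+_; _*_; -_; _-_; ∣_∣)
  import Data.Integer.Properties as ℤP
  import Data.Integer.Divisibility.Signed as ℤ∣
  open import Data.Nat as ℕ using (ℕ; zero; suc; _<_; _≤_; s≤s; z≤n)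
  import Data.Nat.Properties as ℕP
  open import Data.Nat.Divisibility using (_∣_; _∣?_; _∣0; ∣n⇒∣m*n; ∣1⇒≡1)
  open import Data.Nat.Primality using (Prime; euclidsLemma; prime⇒nonTrivial)
  open import Data.List using (List; []; _∷_)
  open import Data.Product using (∃; _×_; _,_)
  open import Data.Sum using (_⊎_; inj₁; inj₂; [_,_]′)
  open import Relation.Binary.PropositionalEquality
  open import Relation.Nullary using (Dec; yes; no; ¬_)
  open import Data.Integer.Tactic.RingSolver using (solve-∀)

  record IsDecPrimeIdeal (𝔭 : ℤ → Set) : Set where
    field
      _∈?       : ∀ a → Dec (𝔭 a)
      0∈        : 𝔭 (+ 0)
      +-closed  : ∀ {a b} → 𝔭 a → 𝔭 b → 𝔭 (a + b)
      -‿closed  : ∀ {a} → 𝔭 a → 𝔭 (- a)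
      *-closedˡ : ∀ b {a} → 𝔭 a → 𝔭 (b * a)
      prime     : ∀ a b → 𝔭 (a * b) → 𝔭 a ⊎ 𝔭 b
      1∉        : ¬ 𝔭 (+ 1)

  ≡0-isDecPrimeIdeal : IsDecPrimeIdeal (_≡ + 0)
  ≡0-isDecPrimeIdeal = record
    { _∈?       = λ a → a ℤ.≟ + 0
    ; 0∈        = refl
    ; +-closed  = λ a≡0 b≡0 → cong₂ _+_ a≡0 b≡0
    ; -‿closed  = cong (λ a → - a)
    ; *-closedˡ = λ b a≡0 → trans (cong (b *_) a≡0) (ℤP.*-zeroʳ b)
    ; prime     = λ a b → ℤP.i*j≡0⇒i≡0∨j≡0 a
    ; 1∉        = λ ()
    }

  ∣∣-isDecPrimeIdeal : ∀ {ℓ} → Prime ℓ → IsDecPrimeIdeal (λ a → ℓ ∣ ∣ a ∣)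
  ∣∣-isDecPrimeIdeal {ℓ} ℓ-prime = record
    { _∈?       = λ a → ℓ ∣? ∣ a ∣
    ; 0∈        = ℓ ∣0
    ; +-closed  = λ {a} {b} ℓ∣a ℓ∣b → ℤ∣.∣⇒∣ᵤ {+ ℓ} {a + b}
                    (ℤ∣.∣m∣n⇒∣m+n (ℤ∣.∣ᵤ⇒∣ {+ ℓ} {a} ℓ∣a) (ℤ∣.∣ᵤ⇒∣ {+ ℓ} {b} ℓ∣b))
    ; -‿closed  = λ {a} → subst (ℓ ∣_) (sym (ℤP.∣-i∣≡∣i∣ a))
    ; *-closedˡ = λ b {a} ℓ∣a → subst (ℓ ∣_) (sym (ℤP.abs-* b a)) (∣n⇒∣m*n ∣ b ∣ ℓ∣a)
    ; prime     = λ a b ℓ∣ab → euclidsLemma ∣ a ∣ ∣ b ∣ ℓ-prime (subst (ℓ ∣_) (ℤP.abs-* a b) ℓ∣ab)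
    ; 1∉        = λ ℓ∣1 → ℕ.nonTrivial⇒≢1 {{prime⇒nonTrivial ℓ-prime}} (∣1⇒≡1 ℓ∣1)
    }

  module Modulo {𝔭 : ℤ → Set} (isDecPrimeIdeal : IsDecPrimeIdeal 𝔭) where

    open IsDecPrimeIdeal isDecPrimeIdeal public
    open IntegerPolynomial

    *-closedʳ : ∀ {a} b → 𝔭 a → 𝔭 (a * b)
    *-closedʳ {a} b a∈ = subst 𝔭 (ℤP.*-comm b a) (*-closedˡ b a∈)

    -closed : ∀ {a b} → 𝔭 a → 𝔭 b → 𝔭 (a - b)
    -closed a∈ b∈ = +-closed a∈ (-‿closed b∈)

    ∈-by-differenceʳ : ∀ {a b} → 𝔭 (a - b) → 𝔭 b → 𝔭 a
    ∈-by-differenceʳ {a} {b} a-b∈ b∈ = subst 𝔭 (lemma a b) (+-closed a-b∈ b∈)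
      where
      lemma : ∀ a b → a - b + b ≡ a
      lemma = solve-∀

    ∈-by-differenceˡ : ∀ {a b} → 𝔭 (a - b) → 𝔭 a → 𝔭 b
    ∈-by-differenceˡ {a} {b} a-b∈ a∈ = subst 𝔭 (lemma a b) (-closed a∈ a-b∈)
      where
      lemma : ∀ a b → a - (a - b) ≡ b
      lemma = solve-∀

    ∈-by-sumˡ : ∀ {a b} → 𝔭 (a + b) → 𝔭 a → 𝔭 b
    ∈-by-sumˡ {a} {b} a+b∈ a∈ = subst 𝔭 (lemma a b) (-closed a+b∈ a∈)
      where
      lemma : ∀ a b → a + b - a ≡ b
      lemma = solve-∀

    ∈-by-sumʳ : ∀ {a b} → 𝔭 (a + b) → 𝔭 b → 𝔭 a
    ∈-by-sumʳ {a} {b} a+b∈ = ∈-by-sumˡ (subst 𝔭 (ℤP.+-comm a b) a+b∈)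

    Vanishes : List ℤ → Set
    Vanishes p = ∀ k → 𝔭 (coeff p k)

    HasDegree : List ℤ → ℕ → Set
    HasDegree p t = ¬ 𝔭 (coeff p t) × (∀ j → t < j → 𝔭 (coeff p j))

    coeffs-HasDegree : ∀ h → ¬ 𝔭 (lead h) → HasDegree (coeffs h) (deg h)
    coeffs-HasDegree h lead∉ = (λ ∈ → lead∉ (subst 𝔭 (coeff-coeffs-deg h) ∈))
                             , λ j deg<j → subst 𝔭 (sym (coeff-coeffs-> h j deg<j)) 0∈

    vanishes-or-hasDegree : ∀ p → Vanishes p ⊎ ∃ (HasDegree p)
    vanishes-or-hasDegree []      = inj₁ λ _ → 0∈
    vanishes-or-hasDegree (a ∷ p) with vanishes-or-hasDegree p
    ... | inj₂ (t , t∉ , above) = inj₂ (suc t , t∉ , λ { (suc j) (s≤s t<j) → above j t<j })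
    ... | inj₁ p-vanishes with a ∈?
    ...   | yes a∈ = inj₁ λ { zero → a∈ ; (suc k) → p-vanishes k }
    ...   | no  a∉ = inj₂ (zero , a∉ , λ { (suc j) _ → p-vanishes j })

    Vanishes-cong : ∀ {p q} → p ≋ q → Vanishes p → Vanishes q
    Vanishes-cong e p-vanishes k = subst 𝔭 (coeffwise e k) (p-vanishes k)

    Vanishes-*ₚʳ : ∀ {p} q → Vanishes p → Vanishes (p *ₚ q)
    Vanishes-*ₚʳ {[]}    q _            k = 0∈
    Vanishes-*ₚʳ {a ∷ p} q ∷-vanishes k = subst 𝔭 (sym (coeff-∷*ₚ a p q k))
      (+-closed (*-closedʳ (coeff q k) (∷-vanishes zero)) (shifted k))
      where
      shifted : Vanishes (+ 0 ∷ p *ₚ q)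
      shifted zero    = 0∈
      shifted (suc k) = Vanishes-*ₚʳ {p} q (λ j → ∷-vanishes (suc j)) k

    Vanishes-*ₚˡ : ∀ p {q} → Vanishes q → Vanishes (p *ₚ q)
    Vanishes-*ₚˡ p {q} q-vanishes = Vanishes-cong (*ₚ-comm q p) (Vanishes-*ₚʳ {q} p q-vanishes)

    coeff-*ₚ-above : ∀ A B a b → (∀ i → a < i → 𝔭 (coeff A i)) → (∀ j → b < j → 𝔭 (coeff B j)) →
      𝔭 (coeff (A *ₚ B) (a ℕ.+ b) - coeff A a * coeff B b)
    coeff-*ₚ-above []      B a       b _ _ = 0∈
    coeff-*ₚ-above (x ∷ A) B zero    b A-above _ =
      subst 𝔭 (sym (trans (cong (_- x * coeff B b) (coeff-∷*ₚ x A B b)) (lemma (x * coeff B b) _)))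
        (shifted b)
      where
      shifted : Vanishes (+ 0 ∷ A *ₚ B)
      shifted zero    = 0∈
      shifted (suc k) = Vanishes-*ₚʳ {A} B (λ i → A-above (suc i) (s≤s z≤n)) k
      lemma : ∀ e c → e + c - e ≡ c
      lemma = solve-∀
    coeff-*ₚ-above (x ∷ A) B (suc a) b A-above B-above =
      subst 𝔭 (trans (lemma (x * coeff B (suc (a ℕ.+ b))) (coeff (A *ₚ B) (a ℕ.+ b)) _)
                     (cong (_- coeff A a * coeff B b) (sym (coeff-∷*ₚ x A B (suc (a ℕ.+ b))))))
        (+-closed (*-closedˡ x (B-above (suc (a ℕ.+ b)) (s≤s (ℕP.m≤n+m b a))))
                  (coeff-*ₚ-above A B a b (λ i a<i → A-above (suc i) (s≤s a<i)) B-above))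
      where
      lemma : ∀ e c d → e + (c - d) ≡ e + c - d
      lemma = solve-∀

    HasDegree-*ₚ : ∀ {A B a b} → HasDegree A a → HasDegree B b → ¬ 𝔭 (coeff (A *ₚ B) (a ℕ.+ b))
    HasDegree-*ₚ {A} {B} {a} {b} (Aa∉ , A-above) (Bb∉ , B-above) AB∈ =
      [ Aa∉ , Bb∉ ]′ (prime _ _ (∈-by-differenceˡ (coeff-*ₚ-above A B a b A-above B-above) AB∈))

    Vanishes-cancelʳ : ∀ {v G n} → HasDegree G n → Vanishes (v *ₚ G) → Vanishes v
    Vanishes-cancelʳ {v} {G} {n} G-degree vG-vanishes with vanishes-or-hasDegree v
    ... | inj₁ v-vanishes     = v-vanishes
    ... | inj₂ (t , v-degree) = ⊥-elim (HasDegree-*ₚ {v} {G} v-degree G-degree (vG-vanishes (t ℕ.+ n)))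

    -- P (u F + v G) = r u - G (Q u - P v), and a nonzero Q u - P v would give r u
    -- degree at least deg G modulo 𝔭.
    syzygy-vanishes : ∀ {F G P Q u v n r} → HasDegree G n → P *ₚ F +ₚ Q *ₚ G ≋ C r → ¬ 𝔭 r →
      (∀ k → n ≤ k → 𝔭 (coeff u k)) → Vanishes (u *ₚ F +ₚ v *ₚ G) → Vanishes u × Vanishes v
    syzygy-vanishes {F} {G} {P} {Q} {u} {v} {n} {r} G-degree bezout r∉ u-above syzygy =
      u-vanishes , v-vanishes
      where
      w = Q *ₚ u -ₚ P *ₚ v

      ru-Gw : ∀ k → 𝔭 (r * coeff u k - coeff (G *ₚ w) k)
      ru-Gw k = subst 𝔭 coeff-ru-Gw
        (Vanishes-cong (≋-trans (syzygy-identity P Q F G u v) (+ₚ-cong (*ₚ-congʳ u bezout) ≋-refl))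
          (Vanishes-*ₚˡ P syzygy) k)
        where
        coeff-ru-Gw : coeff (C r *ₚ u -ₚ G *ₚ w) k ≡ r * coeff u k - coeff (G *ₚ w) k
        coeff-ru-Gw = trans (coeff-+ₚ (C r *ₚ u) _ k) (cong₂ _+_ (coeff-C*ₚ r u k) (coeff--ₚ (G *ₚ w) k))

      w-vanishes : Vanishes w
      w-vanishes with vanishes-or-hasDegree w
      ... | inj₁ w-vanishes     = w-vanishes
      ... | inj₂ (t , w-degree) = ⊥-elim (HasDegree-*ₚ {G} {w} G-degree w-degree
              (∈-by-differenceˡ (ru-Gw (n ℕ.+ t)) (*-closedˡ r (u-above (n ℕ.+ t) (ℕP.m≤m+n n t)))))

      u-vanishes : Vanishes u
      u-vanishes k = [ (λ r∈ → ⊥-elim (r∉ r∈)) , (λ u∈ → u∈) ]′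
        (prime r (coeff u k) (∈-by-differenceʳ (ru-Gw k) (Vanishes-*ₚˡ G w-vanishes k)))

      v-vanishes : Vanishes v
      v-vanishes = Vanishes-cancelʳ {v} {G} G-degree λ k →
        ∈-by-sumˡ (subst 𝔭 (coeff-+ₚ (u *ₚ F) (v *ₚ G) k) (syzygy k)) (Vanishes-*ₚʳ {u} F u-vanishes k)

module Determinant where

  open import Data.Empty using (⊥-elim)
  open import Data.Fin as Fin using (Fin; zero; suc; toℕ; punchIn; punchOut; inject₁; fromℕ<)
  import Data.Fin.Properties as FinP
  open import Data.Integer as ℤ using (ℤ; +_; _+_; _*_; -_; _^_)
  import Data.Integer.Properties as ℤP
  open import Data.Nat as ℕ using (ℕ; zero; suc; _<_; _≤_)
  import Data.Nat.Properties as ℕP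
  open import Data.Product using (∃; _×_; _,_)
  open import Data.Sum using (_⊎_; inj₁; inj₂)
  open import Function using (_∘_)
  open import Relation.Binary.PropositionalEquality
  open import Relation.Nullary using (Dec; yes; no; ¬_)
  open import Data.Integer.Tactic.RingSolver using (solve-∀)
  open import Algebra.Properties.Semiring.Sum ℤP.+-*-semiring public
    using (sum; sum-cong-≗; sum-replicate-zero; sum-remove; ∑-distrib-+; ∑-comm; *-distribˡ-sum)
  open ≡-Reasoning

  Matrix : ℕ → Set
  Matrix n = Fin n → Fin n → ℤ

  sgn : ∀ {n} → Fin n → ℤ
  sgn j = (- + 1) ^ toℕ j

  sgn-suc : ∀ {n} (j : Fin n) → sgn (suc j) ≡ - sgn j
  sgn-suc j = ℤP.-1*i≡-i (sgn j)

  minor : ∀ {n} → Matrix (suc n) → Fin (suc n) → Fin (suc n) → Matrix n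
  minor M i j r c = M (punchIn i r) (punchIn j c)

  sumℤ≡sum : ∀ {n} (f : Fin n → ℤ) → sumℤ f ≡ sum f
  sumℤ≡sum {zero}  f = refl
  sumℤ≡sum {suc n} f = cong (λ x → f zero + x) (sumℤ≡sum (f ∘ suc))

  sum-zero : ∀ {n} (f : Fin n → ℤ) → (∀ i → f i ≡ + 0) → sum f ≡ + 0
  sum-zero {n} f f≡0 = trans (sum-cong-≗ f≡0) (sum-replicate-zero n)

  sum-single : ∀ {n} (f : Fin (suc n) → ℤ) i → (∀ k → k ≢ i → f k ≡ + 0) → sum f ≡ f i
  sum-single f i others = begin
    sum f                           ≡⟨ sum-remove {i = i} f ⟩
    f i + sum (f ∘ punchIn i)       ≡⟨ cong (λ x → f i + x) (sum-zero _ λ r → others _ (FinP.punchInᵢ≢i i r)) ⟩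
    f i + + 0                       ≡⟨ ℤP.+-identityʳ _ ⟩
    f i                             ∎

  sum-pair : ∀ {n} (f : Fin (suc (suc n)) → ℤ) {a b} → a ≢ b →
    (∀ k → k ≢ a → k ≢ b → f k ≡ + 0) → sum f ≡ f a + f b
  sum-pair f {a} {b} a≢b others = begin
    sum f                        ≡⟨ sum-remove {i = a} f ⟩
    f a + sum (f ∘ punchIn a)    ≡⟨ cong (λ x → f a + x) (sum-single (f ∘ punchIn a) (punchOut a≢b) others′) ⟩
    f a + f (punchIn a b′)       ≡⟨ cong (λ k → f a + f k) (FinP.punchIn-punchOut a≢b) ⟩
    f a + f b                    ∎
    where
    b′ = punchOut a≢b
    others′ : ∀ r → r ≢ b′ → f (punchIn a r) ≡ + 0
    others′ r r≢b′ = others _ (FinP.punchInᵢ≢i a r) λ e →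
      r≢b′ (FinP.punchIn-injective a r b′ (trans e (sym (FinP.punchIn-punchOut a≢b))))

  det-expand : ∀ {n} (M : Matrix (suc n)) → det M ≡ sum (λ j → sgn j * (M zero j * det (minor M zero j)))
  det-expand M = sumℤ≡sum (λ j → sgn j * (M zero j * det (minor M zero j)))

  det-cong : ∀ {n} {M N : Matrix n} → (∀ r c → M r c ≡ N r c) → det M ≡ det N
  det-cong {zero}  _   = refl
  det-cong {suc n} {M} {N} M≡N = trans (det-expand M) (trans (sum-cong-≗ λ j →
      cong₂ (λ x y → sgn j * (x * y)) (M≡N zero j) (det-cong λ r c → M≡N (suc r) (punchIn j c)))
    (sym (det-expand N)))

  det-expand-col₀ : ∀ {n} (M : Matrix (suc n)) →
    det M ≡ sum (λ i → sgn i * (M i zero * det (minor M i zero)))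
  det-expand-col₀ {zero}  M = refl
  det-expand-col₀ {suc n} M = trans (det-expand M) (cong (λ x → T₀ + x) (begin
    sum (λ j → sgn (suc j) * (M zero (suc j) * det (minor M zero (suc j))))
      ≡⟨ sum-cong-≗ (λ j → cong (λ d → sgn (suc j) * (M zero (suc j) * d)) (det-expand-col₀ (minor M zero (suc j)))) ⟩
    sum (λ j → sgn (suc j) * (M zero (suc j) * sum (column j)))
      ≡⟨ sum-cong-≗ (λ j → trans (cong (sgn (suc j) *_) (*-distribˡ-sum (M zero (suc j)) (column j)))
                                 (*-distribˡ-sum (sgn (suc j)) (λ i → M zero (suc j) * column j i))) ⟩
    sum (λ j → sum (λ i → term i j))
      ≡⟨ ∑-comm (λ j i → term i j) ⟩
    sum (λ i → sum (λ j → term i j))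
      ≡⟨ sum-cong-≗ (λ i → sum-cong-≗ (λ j → swap-factors i j)) ⟩
    sum (λ i → sum (λ j → sgn (suc i) * (M (suc i) zero * row i j)))
      ≡⟨ sum-cong-≗ (λ i → sym (trans (cong (sgn (suc i) *_) (*-distribˡ-sum (M (suc i) zero) (row i)))
                                      (*-distribˡ-sum (sgn (suc i)) (λ j → M (suc i) zero * row i j)))) ⟩
    sum (λ i → sgn (suc i) * (M (suc i) zero * sum (row i)))
      ≡⟨ sum-cong-≗ (λ i → cong (λ d → sgn (suc i) * (M (suc i) zero * d)) (sym (det-expand (minor M (suc i) zero)))) ⟩
    sum (λ i → sgn (suc i) * (M (suc i) zero * det (minor M (suc i) zero))) ∎))
    where
    T₀ = sgn {suc (suc n)} zero * (M zero zero * det (minor M zero zero))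
    D : Fin (suc n) → Fin (suc n) → ℤ
    D i j = det (λ r c → M (suc (punchIn i r)) (suc (punchIn j c)))
    column row : Fin (suc n) → Fin (suc n) → ℤ
    column j i = sgn i * (M (suc i) zero * D i j)
    row i j = sgn j * (M zero (suc j) * D i j)
    term : Fin (suc n) → Fin (suc n) → ℤ
    term i j = sgn (suc j) * (M zero (suc j) * column j i)
    lemma : ∀ sj si a b d → (- sj) * (a * (si * (b * d))) ≡ (- si) * (b * (sj * (a * d)))
    lemma = solve-∀
    swap-factors : ∀ i j → term i j ≡ sgn (suc i) * (M (suc i) zero * row i j)
    swap-factors i j = begin
      sgn (suc j) * (M zero (suc j) * column j i)  ≡⟨ cong (_* (M zero (suc j) * column j i)) (sgn-suc j) ⟩
      (- sgn j) * (M zero (suc j) * column j i)    ≡⟨ lemma (sgn j) (sgn i) (M zero (suc j)) (M (suc i) zero) (D i j) ⟩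
      (- sgn i) * (M (suc i) zero * row i j)       ≡⟨ cong (_* (M (suc i) zero * row i j)) (sgn-suc i) ⟨
      sgn (suc i) * (M (suc i) zero * row i j)     ∎

  det-minor-cong : ∀ {n} {M N : Matrix (suc n)} j → (∀ r x → x ≢ j → M r x ≡ N r x) →
    det (minor M zero j) ≡ det (minor N zero j)
  det-minor-cong j same = det-cong λ r x → same (suc r) (punchIn j x) (FinP.punchInᵢ≢i j x)

  det-linear-col : ∀ {n} {M M₁ M₂ : Matrix n} c a b → (∀ r → M r c ≡ a * M₁ r c + b * M₂ r c) →
    (∀ r x → x ≢ c → M r x ≡ M₁ r x) → (∀ r x → x ≢ c → M r x ≡ M₂ r x) →
    det M ≡ a * det M₁ + b * det M₂
  det-linear-col {suc n} {M} {M₁} {M₂} c a b col-c same₁ same₂ = begin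
    det M                                   ≡⟨ det-expand M ⟩
    sum (λ j → T M j)                       ≡⟨ sum-cong-≗ term ⟩
    sum (λ j → a * T M₁ j + b * T M₂ j)     ≡⟨ ∑-distrib-+ (λ j → a * T M₁ j) (λ j → b * T M₂ j) ⟩
    sum (λ j → a * T M₁ j) + sum (λ j → b * T M₂ j)
      ≡⟨ cong₂ _+_ (*-distribˡ-sum a (T M₁)) (*-distribˡ-sum b (T M₂)) ⟨
    a * sum (T M₁) + b * sum (T M₂)         ≡⟨ cong₂ (λ x y → a * x + b * y) (det-expand M₁) (det-expand M₂) ⟨
    a * det M₁ + b * det M₂                 ∎
    where
    T : Matrix (suc n) → Fin (suc n) → ℤ
    T N j = sgn j * (N zero j * det (minor N zero j))
    term : ∀ j → T M j ≡ a * T M₁ j + b * T M₂ j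
    term j with j Fin.≟ c
    ... | yes refl = begin
      sgn j * (M zero j * det (minor M zero j))
        ≡⟨ cong₂ (λ x d → sgn j * (x * d)) (col-c zero) (det-minor-cong j same₁) ⟩
      sgn j * ((a * M₁ zero j + b * M₂ zero j) * det (minor M₁ zero j))
        ≡⟨ lemma (sgn j) a b (M₁ zero j) (M₂ zero j) (det (minor M₁ zero j)) ⟩
      a * T M₁ j + b * (sgn j * (M₂ zero j * det (minor M₁ zero j)))
        ≡⟨ cong (λ d → a * T M₁ j + b * (sgn j * (M₂ zero j * d)))
             (det-minor-cong j λ r x x≢j → trans (sym (same₁ r x x≢j)) (same₂ r x x≢j)) ⟩
      a * T M₁ j + b * T M₂ j ∎
      where
      lemma : ∀ s a b x y d → s * ((a * x + b * y) * d) ≡ a * (s * (x * d)) + b * (s * (y * d))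
      lemma = solve-∀
    ... | no j≢c = begin
      sgn j * (M zero j * det (minor M zero j))
        ≡⟨ cong₂ (λ x d → sgn j * (x * d)) (same₁ zero j j≢c) (det-linear-col c′ a b col-c′
             (λ r x x≢ → same₁ (suc r) _ (avoid x x≢)) (λ r x x≢ → same₂ (suc r) _ (avoid x x≢))) ⟩
      sgn j * (M₁ zero j * (a * det (minor M₁ zero j) + b * det (minor M₂ zero j)))
        ≡⟨ lemma (sgn j) (M₁ zero j) a b (det (minor M₁ zero j)) (det (minor M₂ zero j)) ⟩
      a * T M₁ j + b * (sgn j * (M₁ zero j * det (minor M₂ zero j)))
        ≡⟨ cong (λ x → a * T M₁ j + b * (sgn j * (x * det (minor M₂ zero j))))
             (trans (sym (same₁ zero j j≢c)) (same₂ zero j j≢c)) ⟩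
      a * T M₁ j + b * T M₂ j ∎
      where
      c′ = punchOut j≢c
      col-c′ : ∀ r → minor M zero j r c′ ≡ a * minor M₁ zero j r c′ + b * minor M₂ zero j r c′
      col-c′ r = subst (λ x → M (suc r) x ≡ a * M₁ (suc r) x + b * M₂ (suc r) x)
                       (sym (FinP.punchIn-punchOut j≢c)) (col-c (suc r))
      avoid : ∀ x → x ≢ c′ → punchIn j x ≢ c
      avoid x x≢ e = x≢ (FinP.punchIn-injective j x _ (trans e (sym (FinP.punchIn-punchOut j≢c))))
      lemma : ∀ s m a b d₁ d₂ → s * (m * (a * d₁ + b * d₂)) ≡ a * (s * (m * d₁)) + b * (s * (m * d₂))
      lemma = solve-∀

  det-additive-col : ∀ {n} {M M₁ M₂ : Matrix n} c → (∀ r → M r c ≡ M₁ r c + M₂ r c) →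
    (∀ r x → x ≢ c → M r x ≡ M₁ r x) → (∀ r x → x ≢ c → M r x ≡ M₂ r x) →
    det M ≡ det M₁ + det M₂
  det-additive-col {M = M} {M₁} {M₂} c col-c same₁ same₂ =
    trans (det-linear-col c (+ 1) (+ 1) (λ r → trans (col-c r) (sym (one r))) same₁ same₂)
          (cong₂ _+_ (ℤP.*-identityˡ (det M₁)) (ℤP.*-identityˡ (det M₂)))
    where
    one : ∀ r → + 1 * M₁ r c + + 1 * M₂ r c ≡ M₁ r c + M₂ r c
    one r = cong₂ _+_ (ℤP.*-identityˡ (M₁ r c)) (ℤP.*-identityˡ (M₂ r c))

  punchIn-inject₁-suc : ∀ {n} (j c : Fin n) →
    punchIn (inject₁ j) c ≡ punchIn (suc j) c ⊎ (punchIn (inject₁ j) c ≡ suc j × punchIn (suc j) c ≡ inject₁ j)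
  punchIn-inject₁-suc zero    zero    = inj₂ (refl , refl)
  punchIn-inject₁-suc zero    (suc c) = inj₁ refl
  punchIn-inject₁-suc (suc j) zero    = inj₁ refl
  punchIn-inject₁-suc (suc j) (suc c) with punchIn-inject₁-suc j c
  ... | inj₁ e         = inj₁ (cong suc e)
  ... | inj₂ (e₁ , e₂) = inj₂ (cong suc e₁ , cong suc e₂)

  punchIn-avoiding-inject₁-suc : ∀ {n} (k : Fin (suc (suc n))) (j : Fin (suc n)) → k ≢ inject₁ j → k ≢ suc j →
    ∃ λ (j′ : Fin n) → punchIn k (inject₁ j′) ≡ inject₁ j × punchIn k (suc j′) ≡ suc j
  punchIn-avoiding-inject₁-suc zero          zero    k≢a _   = ⊥-elim (k≢a refl)
  punchIn-avoiding-inject₁-suc zero          (suc j) _   _   = j , refl , refl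
  punchIn-avoiding-inject₁-suc (suc zero)    zero    _   k≢b = ⊥-elim (k≢b refl)
  punchIn-avoiding-inject₁-suc {suc n} (suc (suc k)) zero _ _ = zero , refl , refl
  punchIn-avoiding-inject₁-suc {suc n} (suc k) (suc j) k≢a k≢b
    with punchIn-avoiding-inject₁-suc k j (k≢a ∘ cong suc) (k≢b ∘ cong suc)
  ... | j′ , e₁ , e₂ = suc j′ , cong suc e₁ , cong suc e₂

  -- The first-row terms at columns j and j+1 have equal minors and opposite signs; every
  -- other minor again has two equal adjacent columns.
  det-adjacent-cols-equal : ∀ {n} (M : Matrix (suc n)) (j : Fin n) →
    (∀ r → M r (inject₁ j) ≡ M r (suc j)) → det M ≡ + 0
  det-adjacent-cols-equal {suc n} M j cols≡ = begin
    det M                          ≡⟨ det-expand M ⟩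
    sum T                          ≡⟨ sum-pair T inject₁≢suc others ⟩
    T (inject₁ j) + T (suc j)      ≡⟨ cong₂ (λ s x → s * (x * det (minor M zero (inject₁ j))) + T (suc j))
                                            (cong (λ k → (- + 1) ^ k) (FinP.toℕ-inject₁ j)) (cols≡ zero) ⟩
    sgn j * (m * d) + T (suc j)    ≡⟨ cong₂ (λ s x → sgn j * (m * d) + s * (m * x)) (sgn-suc j) (sym minors≡) ⟩
    sgn j * (m * d) + (- sgn j) * (m * d) ≡⟨ lemma (sgn j) (m * d) ⟩
    + 0                            ∎
    where
    T : Fin (suc (suc n)) → ℤ
    T k = sgn k * (M zero k * det (minor M zero k))
    m = M zero (suc j)
    d = det (minor M zero (inject₁ j))
    inject₁≢suc : inject₁ j ≢ suc j
    inject₁≢suc e = ℕP.1+n≢n (trans (sym (cong toℕ e)) (FinP.toℕ-inject₁ j))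
    minors≡ : det (minor M zero (inject₁ j)) ≡ det (minor M zero (suc j))
    minors≡ = det-cong λ r c → case r c (punchIn-inject₁-suc j c)
      where
      case : ∀ r c → _ → M (suc r) (punchIn (inject₁ j) c) ≡ M (suc r) (punchIn (suc j) c)
      case r c (inj₁ e)         = cong (M (suc r)) e
      case r c (inj₂ (e₁ , e₂)) = trans (cong (M (suc r)) e₁) (trans (sym (cols≡ (suc r))) (cong (M (suc r)) (sym e₂)))
    others : ∀ k → k ≢ inject₁ j → k ≢ suc j → T k ≡ + 0
    others k k≢a k≢b with punchIn-avoiding-inject₁-suc k j k≢a k≢b
    ... | j′ , e₁ , e₂ = trans
      (cong (λ x → sgn k * (M zero k * x)) (det-adjacent-cols-equal (minor M zero k) j′ λ r →
        trans (cong (M (suc r)) e₁) (trans (cols≡ (suc r)) (cong (M (suc r)) (sym e₂)))))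
      (trans (cong (sgn k *_) (ℤP.*-zeroʳ (M zero k))) (ℤP.*-zeroʳ (sgn k)))
    lemma : ∀ s x → s * x + (- s) * x ≡ + 0
    lemma = solve-∀

  setCol : ∀ {n} → Matrix n → Fin n → (Fin n → ℤ) → Matrix n
  setCol M c v r x with x Fin.≟ c
  ... | yes _ = v r
  ... | no  _ = M r x

  setCol-≡ : ∀ {n} (M : Matrix n) c v r → setCol M c v r c ≡ v r
  setCol-≡ M c v r with c Fin.≟ c
  ... | yes _  = refl
  ... | no c≢c = ⊥-elim (c≢c refl)

  setCol-≢ : ∀ {n} (M : Matrix n) c v r {x} → x ≢ c → setCol M c v r x ≡ M r x
  setCol-≢ M c v r {x} x≢c with x Fin.≟ c
  ... | yes x≡c = ⊥-elim (x≢c x≡c)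
  ... | no  _   = refl

  swapCols : ∀ {n} → Matrix n → Fin n → Fin n → Matrix n
  swapCols M a b = setCol (setCol M a (λ r → M r b)) b (λ r → M r a)

  swapCols-≡ˡ : ∀ {n} (M : Matrix n) {a b} r → a ≢ b → swapCols M a b r a ≡ M r b
  swapCols-≡ˡ M {a} {b} r a≢b = trans (setCol-≢ _ b _ r a≢b) (setCol-≡ M a _ r)

  swapCols-≢ : ∀ {n} (M : Matrix n) {a b} r {x} → x ≢ a → x ≢ b → swapCols M a b r x ≡ M r x
  swapCols-≢ M {a} {b} r x≢a x≢b = trans (setCol-≢ _ b _ r x≢b) (setCol-≢ M a _ r x≢a)

  module AdjacentColumns {n} (M : Matrix (suc n)) (j : Fin n) where

    a b : Fin (suc n)
    a = inject₁ j
    b = suc j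

    a≢b : a ≢ b
    a≢b e = ℕP.1+n≢n (trans (sym (cong toℕ e)) (FinP.toℕ-inject₁ j))

    replace : (Fin (suc n) → ℤ) → (Fin (suc n) → ℤ) → Matrix (suc n)
    replace u v = setCol (setCol M a u) b v

    replace-a : ∀ u v r → replace u v r a ≡ u r
    replace-a u v r = trans (setCol-≢ _ b v r a≢b) (setCol-≡ M a u r)

    replace-b : ∀ u v r → replace u v r b ≡ v r
    replace-b u v r = setCol-≡ _ b v r

    replace-≢a : ∀ u u′ v r x → x ≢ a → replace u v r x ≡ replace u′ v r x
    replace-≢a u u′ v r x x≢a = by-cases x x≢a (x Fin.≟ b)
      where
      by-cases : ∀ x → x ≢ a → Dec (x ≡ b) → replace u v r x ≡ replace u′ v r x
      by-cases x _   (yes refl) = trans (replace-b u v r) (sym (replace-b u′ v r))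
      by-cases x x≢a (no x≢b)   = trans (setCol-≢ _ b v r x≢b)
        (trans (setCol-≢ M a u r x≢a) (sym (trans (setCol-≢ _ b v r x≢b) (setCol-≢ M a u′ r x≢a))))

    replace-≢b : ∀ u v v′ r x → x ≢ b → replace u v r x ≡ replace u v′ r x
    replace-≢b u v v′ r x x≢b = trans (setCol-≢ _ b v r x≢b) (sym (setCol-≢ _ b v′ r x≢b))

    det-replace-equal : ∀ u → det (replace u u) ≡ + 0
    det-replace-equal u = det-adjacent-cols-equal (replace u u) j λ r → trans (replace-a u u r) (sym (replace-b u u r))

    det-replace-additiveˡ : ∀ u u′ v → det (replace (λ r → u r + u′ r) v) ≡ det (replace u v) + det (replace u′ v)
    det-replace-additiveˡ u u′ v = det-additive-col a
      (λ r → trans (replace-a (λ r → u r + u′ r) v r) (sym (cong₂ _+_ (replace-a u v r) (replace-a u′ v r))))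
      (λ r x x≢a → replace-≢a (λ r → u r + u′ r) u v r x x≢a)
      (λ r x x≢a → replace-≢a (λ r → u r + u′ r) u′ v r x x≢a)

    det-replace-additiveʳ : ∀ u v v′ → det (replace u (λ r → v r + v′ r)) ≡ det (replace u v) + det (replace u v′)
    det-replace-additiveʳ u v v′ = det-additive-col b
      (λ r → trans (replace-b u (λ r → v r + v′ r) r) (sym (cong₂ _+_ (replace-b u v r) (replace-b u v′ r))))
      (λ r x x≢b → replace-≢b u (λ r → v r + v′ r) v r x x≢b)
      (λ r x x≢b → replace-≢b u (λ r → v r + v′ r) v′ r x x≢b)

    det-replace-identity : det (replace (λ r → M r a) (λ r → M r b)) ≡ det M
    det-replace-identity = det-cong λ r x → entry r x (x Fin.≟ a) (x Fin.≟ b)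
      where
      entry : ∀ r x → Dec (x ≡ a) → Dec (x ≡ b) → replace (λ r → M r a) (λ r → M r b) r x ≡ M r x
      entry r x _          (yes refl) = replace-b _ _ r
      entry r x (yes refl) (no _)     = replace-a _ _ r
      entry r x (no x≢a)   (no x≢b)   = trans (setCol-≢ _ b _ r x≢b) (setCol-≢ M a _ r x≢a)

  -- Multilinearity in the two columns: 0 = det (replace (u + v) (u + v)) expands to
  -- det M + det (swapCols M a b).
  det-swap-adjacent-cols : ∀ {n} (M : Matrix (suc n)) (j : Fin n) →
    det (swapCols M (inject₁ j) (suc j)) ≡ - det M
  det-swap-adjacent-cols M j = begin
    det (replace v u)                         ≡⟨ lemma (det M) (det (replace v u)) ⟩
    - det M + (det M + det (replace v u))     ≡⟨ cong (λ x → - det M + x) expansion ⟨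
    - det M + + 0                             ≡⟨ ℤP.+-identityʳ _ ⟩
    - det M                                   ∎
    where
    open AdjacentColumns M j
    u v w : Fin _ → ℤ
    u r = M r a
    v r = M r b
    w r = u r + v r
    expansion : + 0 ≡ det M + det (replace v u)
    expansion = begin
      + 0                                                               ≡⟨ det-replace-equal w ⟨
      det (replace w w)                                                 ≡⟨ det-replace-additiveˡ u v w ⟩
      det (replace u w) + det (replace v w)
        ≡⟨ cong₂ _+_ (det-replace-additiveʳ u u v) (det-replace-additiveʳ v u v) ⟩
      (det (replace u u) + det (replace u v)) + (det (replace v u) + det (replace v v))
        ≡⟨ cong₂ (λ x y → (x + det (replace u v)) + (det (replace v u) + y)) (det-replace-equal u) (det-replace-equal v) ⟩
      (+ 0 + det (replace u v)) + (det (replace v u) + + 0)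
        ≡⟨ cong₂ _+_ (trans (ℤP.+-identityˡ _) det-replace-identity) (ℤP.+-identityʳ _) ⟩
      det M + det (replace v u)                                         ∎
    lemma : ∀ x y → y ≡ - x + (x + y)
    lemma = solve-∀

  -- Induction on k = toℕ j: an adjacent swap moves the copy of column 0 one step left.
  private
    det-col₀-equal′ : ∀ k {n} (M : Matrix (suc n)) (j : Fin n) → toℕ j ≡ k →
      (∀ r → M r zero ≡ M r (suc j)) → det M ≡ + 0
    det-col₀-equal′ _       M zero    _  cols≡ = det-adjacent-cols-equal M zero cols≡
    det-col₀-equal′ (suc k) {suc n} M (suc j) tj cols≡ = trans (sym (ℤP.neg-involutive (det M)))
      (cong (λ x → - x) (trans (sym (det-swap-adjacent-cols M (suc j)))
        (det-col₀-equal′ k S (inject₁ j)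
          (trans (FinP.toℕ-inject₁ j) (ℕP.suc-injective tj)) swapped≡)))
      where
      S = swapCols M (suc (inject₁ j)) (suc (suc j))
      swapped≡ : ∀ r → S r zero ≡ S r (suc (inject₁ j))
      swapped≡ r = trans (swapCols-≢ M {suc (inject₁ j)} {suc (suc j)} r (λ ()) (λ ()))
        (trans (cols≡ r) (sym (swapCols-≡ˡ M r (AdjacentColumns.a≢b M (suc j)))))

  det-col₀-equal : ∀ {n} (M : Matrix (suc n)) (j : Fin n) → (∀ r → M r zero ≡ M r (suc j)) → det M ≡ + 0
  det-col₀-equal M j = det-col₀-equal′ (toℕ j) M j refl

  rowComb : ∀ {k d} → (Fin k → ℤ) → (Fin k → Fin d → ℤ) → Fin d → ℤ
  rowComb y M c = sum (λ r → y r * M r c)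

  cofactor : ∀ {n} → Matrix (suc n) → Fin (suc n) → ℤ
  cofactor M i = sgn i * det (minor M i zero)

  rowComb-cofactor-zero : ∀ {n} (M : Matrix (suc n)) → rowComb (cofactor M) M zero ≡ det M
  rowComb-cofactor-zero M = trans (sum-cong-≗ λ i → lemma (sgn i) (det (minor M i zero)) (M i zero))
    (sym (det-expand-col₀ M))
    where
    lemma : ∀ s d m → s * d * m ≡ s * (m * d)
    lemma = solve-∀

  rowComb-cofactor-suc : ∀ {n} (M : Matrix (suc n)) j → rowComb (cofactor M) M (suc j) ≡ + 0
  rowComb-cofactor-suc M j = trans (sum-cong-≗ λ i → lemma (sgn i) (det (minor M i zero)) (M i (suc j)))
    (trans (sym (det-expand-col₀ N)) (det-col₀-equal N j λ r → refl))
    where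
    N : Matrix _
    N r zero    = M r (suc j)
    N r (suc c) = M r (suc c)
    lemma : ∀ s d m → s * d * m ≡ s * (m * d)
    lemma = solve-∀

  det-row₀-pivot : ∀ {n} (M : Matrix (suc n)) → (∀ j → M zero (suc j) ≡ + 0) →
    det M ≡ M zero zero * det (minor M zero zero)
  det-row₀-pivot {n} M row≡0 = begin
    det M                                                   ≡⟨ det-expand M ⟩
    sgn {suc n} zero * (M zero zero * det (minor M zero zero)) + sum (T ∘ suc)
      ≡⟨ cong (λ x → sgn {suc n} zero * (M zero zero * det (minor M zero zero)) + x) (sum-zero (T ∘ suc) T-suc≡0) ⟩
    + 1 * (M zero zero * det (minor M zero zero)) + + 0      ≡⟨ ℤP.+-identityʳ _ ⟩
    + 1 * (M zero zero * det (minor M zero zero))            ≡⟨ ℤP.*-identityˡ _ ⟩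
    M zero zero * det (minor M zero zero)                    ∎
    where
    T : Fin _ → ℤ
    T j = sgn j * (M zero j * det (minor M zero j))
    T-suc≡0 : ∀ j → T (suc j) ≡ + 0
    T-suc≡0 j = trans (cong (λ x → sgn (suc j) * (x * det (minor M zero (suc j)))) (row≡0 j))
                      (trans (cong (sgn (suc j) *_) (ℤP.*-zeroˡ (det (minor M zero (suc j))))) (ℤP.*-zeroʳ (sgn (suc j))))

  module ColumnElimination {n} (M : Matrix (suc n)) (a : ℤ) (t : Fin n → ℤ) where

    eliminated : Matrix (suc n)
    eliminated r zero    = M r zero
    eliminated r (suc c) = a * M r (suc c) + t c * M r zero

    private
      partial : ℕ → Matrix (suc n)
      partial m r zero    = M r zero
      partial m r (suc c) with toℕ c ℕ.<? m
      ... | yes _ = eliminated r (suc c)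
      ... | no  _ = M r (suc c)

      partial-< : ∀ m r c → toℕ c < m → partial m r (suc c) ≡ eliminated r (suc c)
      partial-< m r c c<m with toℕ c ℕ.<? m
      ... | yes _  = refl
      ... | no c≮m = ⊥-elim (c≮m c<m)

      partial-≮ : ∀ m r c → ¬ toℕ c < m → partial m r (suc c) ≡ M r (suc c)
      partial-≮ m r c c≮m with toℕ c ℕ.<? m
      ... | yes c<m = ⊥-elim (c≮m c<m)
      ... | no  _   = refl

      partial-suc : ∀ m (m<n : m < n) r x → x ≢ suc (fromℕ< m<n) → partial (suc m) r x ≡ partial m r x
      partial-suc m m<n r zero    _ = refl
      partial-suc m m<n r (suc c) x≢ = by-cases (toℕ c ℕ.<? m)
        where
        c≢m : toℕ c ≢ m
        c≢m e = x≢ (cong suc (FinP.toℕ-injective (trans e (sym (FinP.toℕ-fromℕ< m<n)))))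
        by-cases : Dec (toℕ c < m) → partial (suc m) r (suc c) ≡ partial m r (suc c)
        by-cases (yes c<m) = trans (partial-< (suc m) r c (ℕP.m<n⇒m<1+n c<m)) (sym (partial-< m r c c<m))
        by-cases (no  c≮m) = trans (partial-≮ (suc m) r c c≮1+m) (sym (partial-≮ m r c c≮m))
          where
          c≮1+m : ¬ toℕ c < suc m
          c≮1+m c<1+m with ℕP.m≤n⇒m<n∨m≡n (ℕP.≤-pred c<1+m)
          ... | inj₁ c<m = c≮m c<m
          ... | inj₂ c≡m = c≢m c≡m

      det-partial-suc : ∀ m (m<n : m < n) → det (partial (suc m)) ≡ a * det (partial m)
      det-partial-suc m m<n = begin
        det (partial (suc m))                  ≡⟨ det-linear-col {M = partial (suc m)} {partial m} {copy} c₀ a (t c) col-c₀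
                                                    (λ r x x≢ → partial-suc m m<n r x x≢)
                                                    (λ r x x≢ → trans (partial-suc m m<n r x x≢)
                                                                        (sym (setCol-≢ (partial m) c₀ (λ r → M r zero) r x≢))) ⟩
        a * det (partial m) + t c * det copy   ≡⟨ cong (λ x → a * det (partial m) + t c * x) copy≡0 ⟩
        a * det (partial m) + t c * + 0        ≡⟨ cong (λ x → a * det (partial m) + x) (ℤP.*-zeroʳ (t c)) ⟩
        a * det (partial m) + + 0              ≡⟨ ℤP.+-identityʳ _ ⟩
        a * det (partial m)                    ∎
        where
        c : Fin n
        c = fromℕ< m<n
        c₀ : Fin (suc n)
        c₀ = suc c
        copy : Matrix (suc n)
        copy = setCol (partial m) c₀ (λ r → M r zero)
        c≮m : ¬ toℕ c < m
        c≮m c<m = ℕP.<-irrefl (FinP.toℕ-fromℕ< m<n) c<m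
        col-c₀ : ∀ r → partial (suc m) r c₀ ≡ a * partial m r c₀ + t c * copy r c₀
        col-c₀ r = trans (partial-< (suc m) r c (ℕP.≤-reflexive (cong suc (FinP.toℕ-fromℕ< m<n))))
          (sym (cong₂ (λ x y → a * x + t c * y) (partial-≮ m r c c≮m) (setCol-≡ (partial m) c₀ (λ r → M r zero) r)))
        copy≡0 : det copy ≡ + 0
        copy≡0 = det-col₀-equal copy c λ r →
          trans (setCol-≢ (partial m) c₀ (λ r → M r zero) r {zero} λ ()) (sym (setCol-≡ (partial m) c₀ (λ r → M r zero) r))

      det-partial : ∀ m → m ≤ n → det (partial m) ≡ a ^ m * det M
      det-partial zero    _   = trans (det-cong {M = partial zero} {M}
                                        λ { r zero → refl ; r (suc c) → partial-≮ zero r c λ () })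
                                      (sym (ℤP.*-identityˡ (det M)))
      det-partial (suc m) m<n = begin
        det (partial (suc m))     ≡⟨ det-partial-suc m m<n ⟩
        a * det (partial m)       ≡⟨ cong (a *_) (det-partial m (ℕP.<⇒≤ m<n)) ⟩
        a * (a ^ m * det M)       ≡⟨ ℤP.*-assoc a (a ^ m) (det M) ⟨
        a ^ suc m * det M         ∎

    det-eliminated : det eliminated ≡ a ^ n * det M
    det-eliminated = trans (det-cong {M = eliminated} {partial n}
                              λ { r zero → refl ; r (suc c) → sym (partial-< n r c (FinP.toℕ<n c)) })
                           (det-partial n ℕP.≤-refl)

module Kernel {𝔭} (isDecPrimeIdeal : PrimeIdeal.IsDecPrimeIdeal 𝔭) where

  open import Data.Empty using (⊥-elim)
  open import Data.Fin using (Fin; zero; suc)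
  open import Data.Fin.Properties using (all?; ¬∀⟶∃¬)
  open import Data.Integer as ℤ using (ℤ; +_; _+_; _*_; -_; _^_)
  import Data.Integer.Properties as ℤP
  open import Data.Nat using (zero; suc)
  open import Data.Product using (∃; _×_; _,_)
  open import Data.Sum using ([_,_]′)
  open import Relation.Binary.PropositionalEquality
  open import Relation.Nullary using (yes; no; ¬_)
  open import Data.Integer.Tactic.RingSolver using (solve-∀)

  open PrimeIdeal.Modulo isDecPrimeIdeal
  open Determinant
  open ≡-Reasoning

  NontrivialKernel : ∀ {k d} → (Fin k → Fin d → ℤ) → Set
  NontrivialKernel M = ∃ λ y → (∃ λ r → ¬ 𝔭 (y r)) × (∀ c → 𝔭 (rowComb y M c))

  row₀-in-𝔭⇒kernel : ∀ {n d} (M : Fin (suc n) → Fin d → ℤ) → (∀ c → 𝔭 (M zero c)) → NontrivialKernel M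
  row₀-in-𝔭⇒kernel M row₀∈ = e₀ , (zero , 1∉) , λ c → subst 𝔭 (sym (rowComb-e₀ c)) (row₀∈ c)
    where
    e₀ : Fin _ → ℤ
    e₀ zero    = + 1
    e₀ (suc _) = + 0
    rowComb-e₀ : ∀ c → rowComb e₀ M c ≡ M zero c
    rowComb-e₀ c = trans (cong₂ _+_ (ℤP.*-identityˡ (M zero c)) (sum-zero _ λ r → ℤP.*-zeroˡ (M (suc r) c)))
                         (ℤP.+-identityʳ _)

  module AddColumn {n} (M : Matrix (suc n)) (j : Fin n) where

    added : Matrix (suc n)
    added r zero    = M r zero + M r (suc j)
    added r (suc c) = M r (suc c)

    det-added : det added ≡ det M
    det-added = begin
      det added
        ≡⟨ det-additive-col {M = added} {M} {copy} zero (λ r → cong (λ x → M r zero + x) (sym (setCol-≡ M zero column r)))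
             (λ { r zero z≢z → ⊥-elim (z≢z refl) ; r (suc c) _ → refl })
             (λ { r zero z≢z → ⊥-elim (z≢z refl) ; r (suc c) x≢ → sym (setCol-≢ M zero column r x≢) }) ⟩
      det M + det copy
        ≡⟨ cong (λ x → det M + x) (det-col₀-equal copy j λ r →
             trans (setCol-≡ M zero column r) (sym (setCol-≢ M zero column r {suc j} λ ()))) ⟩
      det M + + 0         ≡⟨ ℤP.+-identityʳ _ ⟩
      det M               ∎
      where
      column : Fin (suc n) → ℤ
      column r = M r (suc j)
      copy = setCol M zero column

    kernel⇒kernel : NontrivialKernel added → NontrivialKernel M
    kernel⇒kernel (y , nontrivial , y∈) = y , nontrivial , λ
      { zero    → ∈-by-sumʳ (subst 𝔭 rowComb-added (y∈ zero)) (y∈ (suc j))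
      ; (suc c) → y∈ (suc c) }
      where
      rowComb-added : rowComb y added zero ≡ rowComb y M zero + rowComb y M (suc j)
      rowComb-added = trans (sum-cong-≗ λ r → ℤP.*-distribˡ-+ (y r) (M r zero) (M r (suc j)))
                            (∑-distrib-+ (λ r → y r * M r zero) (λ r → y r * M r (suc j)))

  -- One step of fraction-free Gaussian elimination on the columns, with pivot M₀₀.
  module Pivot {n} (M : Matrix (suc n)) where

    a : ℤ
    a = M zero zero

    open ColumnElimination M a (λ c → - M zero (suc c)) public

    reduced : Matrix n
    reduced = minor eliminated zero zero

    a*det-reduced : a * det reduced ≡ a ^ n * det M
    a*det-reduced = trans (sym (det-row₀-pivot eliminated row₀≡0)) det-eliminated
      where
      row₀≡0 : ∀ c → eliminated zero (suc c) ≡ + 0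
      row₀≡0 c = lemma a (M zero (suc c))
        where
        lemma : ∀ a m → a * m + (- m) * a ≡ + 0
        lemma = solve-∀

    kernel⇒kernel : ¬ 𝔭 a → NontrivialKernel reduced → NontrivialKernel M
    kernel⇒kernel a∉ (z , (r₀ , z∉) , z∈) = y , (suc r₀ , y∉) , y∈
      where
      s : ℤ
      s = sum (λ r → z r * M (suc r) zero)
      y : Fin (suc n) → ℤ
      y zero    = - s
      y (suc r) = a * z r
      y∉ : ¬ 𝔭 (a * z r₀)
      y∉ az∈ = [ a∉ , z∉ ]′ (prime a (z r₀) az∈)
      scaled : ∀ c → sum (λ r → a * z r * M (suc r) c) ≡ a * rowComb z (λ r c → M (suc r) c) c
      scaled c = trans (sum-cong-≗ λ r → ℤP.*-assoc a (z r) (M (suc r) c))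
                       (sym (*-distribˡ-sum a (λ r → z r * M (suc r) c)))
      y∈ : ∀ c → 𝔭 (rowComb y M c)
      y∈ zero = subst 𝔭 (sym (begin
        - s * a + sum (λ r → a * z r * M (suc r) zero)   ≡⟨ cong (λ x → - s * a + x) (scaled zero) ⟩
        - s * a + a * s                                  ≡⟨ lemma s a ⟩
        + 0                                              ∎)) 0∈
        where
        lemma : ∀ s a → - s * a + a * s ≡ + 0
        lemma = solve-∀
      y∈ (suc c) = subst 𝔭 (sym (begin
        - s * m + sum (λ r → a * z r * M (suc r) (suc c))     ≡⟨ cong (λ x → - s * m + x) (scaled (suc c)) ⟩
        - s * m + a * t                                      ≡⟨ lemma s m a t ⟩
        a * t + (- m) * s
          ≡⟨ cong₂ _+_ (*-distribˡ-sum a (λ r → z r * M (suc r) (suc c))) (*-distribˡ-sum (- m) (λ r → z r * M (suc r) zero)) ⟩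
        sum (λ r → a * (z r * M (suc r) (suc c))) + sum (λ r → - m * (z r * M (suc r) zero))
          ≡⟨ ∑-distrib-+ (λ r → a * (z r * M (suc r) (suc c))) (λ r → - m * (z r * M (suc r) zero)) ⟨
        sum (λ r → a * (z r * M (suc r) (suc c)) + - m * (z r * M (suc r) zero))
          ≡⟨ sum-cong-≗ (λ r → lemma′ a m (z r) (M (suc r) (suc c)) (M (suc r) zero)) ⟩
        rowComb z reduced c                                  ∎)) (z∈ c)
        where
        m = M zero (suc c)
        t = rowComb z (λ r c → M (suc r) c) (suc c)
        lemma : ∀ s m a t → - s * m + a * t ≡ a * t + (- m) * s
        lemma = solve-∀
        lemma′ : ∀ a m z x x₀ → a * (z * x) + - m * (z * x₀) ≡ z * (a * x + - m * x₀)
        lemma′ = solve-∀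

  singular⇒kernel : ∀ {n} (M : Matrix n) → 𝔭 (det M) → NontrivialKernel M
  pivot⇒kernel : ∀ {n} (M : Matrix (suc n)) → ¬ 𝔭 (M zero zero) → 𝔭 (det M) → NontrivialKernel M

  pivot⇒kernel {n} M a∉ det∈ = Pivot.kernel⇒kernel M a∉ (singular⇒kernel (Pivot.reduced M) reduced∈)
    where
    reduced∈ : 𝔭 (det (Pivot.reduced M))
    reduced∈ = [ (λ a∈ → ⊥-elim (a∉ a∈)) , (λ d∈ → d∈) ]′
      (prime (M zero zero) _ (subst 𝔭 (sym (Pivot.a*det-reduced M)) (*-closedˡ (M zero zero ^ n) det∈)))

  singular⇒kernel {zero}  M det∈ = ⊥-elim (1∉ det∈)
  singular⇒kernel {suc n} M det∈ with M zero zero ∈?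
  ... | no a∉ = pivot⇒kernel M a∉ det∈
  ... | yes a∈ with all? (λ j → M zero (suc j) ∈?)
  ...   | yes row∈ = row₀-in-𝔭⇒kernel M λ { zero → a∈ ; (suc j) → row∈ j }
  ...   | no ¬row∈ with ¬∀⟶∃¬ n _ (λ j → M zero (suc j) ∈?) ¬row∈
  ...     | j , m∉ = AddColumn.kernel⇒kernel M j (pivot⇒kernel (AddColumn.added M j)
                       (λ a+m∈ → m∉ (∈-by-sumˡ a+m∈ a∈)) (subst 𝔭 (sym (AddColumn.det-added M j)) det∈))

module Sylvester (f g : ZPoly⁺) where

  open import Data.Bool using (if_then_else_)
  open import Data.Empty using (⊥-elim)
  open import Data.Fin as Fin using (Fin; zero; suc; toℕ; fromℕ<; _↑ˡ_; _↑ʳ_)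
  import Data.Fin.Properties as FinP
  open import Data.Integer as ℤ using (ℤ; +_; _+_; _*_)
  import Data.Integer.Properties as ℤP
  open import Data.List using (List; length; tabulate)
  import Data.List.Properties as ListP
  open import Data.Nat as ℕ using (ℕ; zero; suc; _<_; _≤_; _∸_; s≤s)
  import Data.Nat.Properties as ℕP
  open import Data.Product using (∃; _,_)
  open import Data.Sum using (_⊎_; inj₁; inj₂; [_,_]′)
  open import Function using (_∘_)
  open import Relation.Binary.PropositionalEquality
  open import Relation.Nullary using (yes; no; ¬_; does)
  open import Relation.Nullary.Decidable using (dec-true; dec-false)

  open IntegerPolynomial
  open Determinant
  open ≡-Reasoning

  F G : List ℤ
  F = coeffs f
  G = coeffs g

  N : ℕ
  N = deg g ℕ.+ deg f

  shiftedCoeff : List ℤ → ℕ → ℕ → ℤ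
  shiftedCoeff B i k = if does (i ℕ.≤? k) then coeff B (k ∸ i) else + 0

  shiftedCoeff-≤ : ∀ B {i k} → i ≤ k → shiftedCoeff B i k ≡ coeff B (k ∸ i)
  shiftedCoeff-≤ B {i} {k} i≤k rewrite dec-true (i ℕ.≤? k) i≤k = refl

  shiftedCoeff-≰ : ∀ B {i k} → ¬ i ≤ k → shiftedCoeff B i k ≡ + 0
  shiftedCoeff-≰ B {i} {k} i≰k rewrite dec-false (i ℕ.≤? k) i≰k = refl

  shiftedCoeff-suc : ∀ B i k → shiftedCoeff B (suc i) (suc k) ≡ shiftedCoeff B i k
  shiftedCoeff-suc B i k with i ℕ.≤? k
  ... | yes i≤k = trans (shiftedCoeff-≤ B (s≤s i≤k)) (sym (shiftedCoeff-≤ B i≤k))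
  ... | no  i≰k = trans (shiftedCoeff-≰ B (i≰k ∘ ℕP.≤-pred)) (sym (shiftedCoeff-≰ B i≰k))

  shiftedCoeff-≥ : ∀ B i k → length B ℕ.+ i ≤ k → shiftedCoeff B i k ≡ + 0
  shiftedCoeff-≥ B i k le with i ℕ.≤? k
  ... | no  i≰k = shiftedCoeff-≰ B i≰k
  ... | yes i≤k = trans (shiftedCoeff-≤ B i≤k) (coeff-≥length B (k ∸ i)
    (subst (_≤ k ∸ i) (ℕP.m+n∸n≡m (length B) i) (ℕP.∸-monoˡ-≤ i le)))

  coeff-tabulate-*ₚ : ∀ {n} (v : Fin n → ℤ) B k →
    coeff (tabulate v *ₚ B) k ≡ sum (λ i → v i * shiftedCoeff B (toℕ i) k)
  coeff-tabulate-*ₚ {zero}  v B k       = refl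
  coeff-tabulate-*ₚ {suc n} v B zero    = trans (coeff-∷*ₚ (v zero) (tabulate (v ∘ suc)) B zero)
    (cong (λ x → v zero * coeff B zero + x) (sym (sum-zero _ λ i → ℤP.*-zeroʳ (v (suc i)))))
  coeff-tabulate-*ₚ {suc n} v B (suc k) = trans (coeff-∷*ₚ (v zero) (tabulate (v ∘ suc)) B (suc k))
    (cong (λ x → v zero * coeff B (suc k) + x) (trans (coeff-tabulate-*ₚ (v ∘ suc) B k)
      (sum-cong-≗ λ i → cong (v (suc i) *_) (sym (shiftedCoeff-suc B (toℕ i) k)))))

  sum-↑ : ∀ m {n} (h : Fin (m ℕ.+ n) → ℤ) → sum h ≡ sum (h ∘ (_↑ˡ n)) + sum (h ∘ (m ↑ʳ_))
  sum-↑ zero        h = sym (ℤP.+-identityˡ _)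
  sum-↑ (suc m) {n} h = trans (cong (λ x → h zero + x) (sum-↑ m (h ∘ suc)))
    (sym (ℤP.+-assoc (h zero) (sum (h ∘ suc ∘ (_↑ˡ n))) (sum (h ∘ suc ∘ (m ↑ʳ_)))))

  sylvester-↑ˡ : ∀ (i : Fin (deg g)) j → sylvester f g (i ↑ˡ deg f) j ≡ shiftedCoeff F (toℕ i) (toℕ j)
  sylvester-↑ˡ i j with toℕ (i ↑ˡ deg f) ℕ.<? deg g
  ... | yes _ = cong (λ t → shiftedCoeff F t (toℕ j)) (FinP.toℕ-↑ˡ i (deg f))
  ... | no i≮ = ⊥-elim (i≮ (subst (_< deg g) (sym (FinP.toℕ-↑ˡ i (deg f))) (FinP.toℕ<n i)))

  sylvester-↑ʳ : ∀ (i : Fin (deg f)) j → sylvester f g (deg g ↑ʳ i) j ≡ shiftedCoeff G (toℕ i) (toℕ j)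
  sylvester-↑ʳ i j with toℕ (deg g ↑ʳ i) ℕ.<? deg g
  ... | yes i< = ⊥-elim (ℕP.m+n≮m (deg g) (toℕ i) (subst (_< deg g) (FinP.toℕ-↑ʳ (deg g) i) i<))
  ... | no  _  = cong (λ t → shiftedCoeff G t (toℕ j))
                      (trans (cong (_∸ deg g) (FinP.toℕ-↑ʳ (deg g) i)) (ℕP.m+n∸m≡n (deg g) (toℕ i)))

  fFactor gFactor : (Fin N → ℤ) → List ℤ
  fFactor y = tabulate (y ∘ (_↑ˡ deg f))
  gFactor y = tabulate (y ∘ (deg g ↑ʳ_))

  sylvesterPoly : (Fin N → ℤ) → List ℤ
  sylvesterPoly y = fFactor y *ₚ F +ₚ gFactor y *ₚ G

  coeff-sylvesterPoly : ∀ y j → coeff (sylvesterPoly y) (toℕ j) ≡ rowComb y (sylvester f g) j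
  coeff-sylvesterPoly y j = begin
    coeff (sylvesterPoly y) (toℕ j)
      ≡⟨ coeff-+ₚ (fFactor y *ₚ F) (gFactor y *ₚ G) (toℕ j) ⟩
    coeff (fFactor y *ₚ F) (toℕ j) + coeff (gFactor y *ₚ G) (toℕ j)
      ≡⟨ cong₂ _+_ (coeff-tabulate-*ₚ (y ∘ (_↑ˡ deg f)) F (toℕ j)) (coeff-tabulate-*ₚ (y ∘ (deg g ↑ʳ_)) G (toℕ j)) ⟩
    sum (λ i → y (i ↑ˡ deg f) * shiftedCoeff F (toℕ i) (toℕ j)) + sum (λ i → y (deg g ↑ʳ i) * shiftedCoeff G (toℕ i) (toℕ j))
      ≡⟨ cong₂ _+_ (sum-cong-≗ λ i → cong (y (i ↑ˡ deg f) *_) (sym (sylvester-↑ˡ i j)))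
                   (sum-cong-≗ λ i → cong (y (deg g ↑ʳ i) *_) (sym (sylvester-↑ʳ i j))) ⟩
    sum (λ i → y (i ↑ˡ deg f) * sylvester f g (i ↑ˡ deg f) j) + sum (λ i → y (deg g ↑ʳ i) * sylvester f g (deg g ↑ʳ i) j)
      ≡⟨ sum-↑ (deg g) (λ i → y i * sylvester f g i j) ⟨
    rowComb y (sylvester f g) j ∎

  coeff-sylvesterPoly-≥ : ∀ y k → N ≤ k → coeff (sylvesterPoly y) k ≡ + 0
  coeff-sylvesterPoly-≥ y k N≤k = begin
    coeff (sylvesterPoly y) k
      ≡⟨ coeff-+ₚ (fFactor y *ₚ F) (gFactor y *ₚ G) k ⟩
    coeff (fFactor y *ₚ F) k + coeff (gFactor y *ₚ G) k
      ≡⟨ cong₂ _+_ (coeff-tabulate-*ₚ (y ∘ (_↑ˡ deg f)) F k) (coeff-tabulate-*ₚ (y ∘ (deg g ↑ʳ_)) G k) ⟩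
    sum (λ i → y (i ↑ˡ deg f) * shiftedCoeff F (toℕ i) k) + sum (λ i → y (deg g ↑ʳ i) * shiftedCoeff G (toℕ i) k)
      ≡⟨ cong₂ _+_ (sum-zero _ λ i → trans (cong (y (i ↑ˡ deg f) *_) (shiftedCoeff-≥ F (toℕ i) k
                                           (ℕP.≤-trans (beyond f g i) (ℕP.≤-trans (ℕP.≤-reflexive (ℕP.+-comm (deg f) (deg g))) N≤k))))
                                         (ℤP.*-zeroʳ (y (i ↑ˡ deg f))))
                   (sum-zero _ λ i → trans (cong (y (deg g ↑ʳ i) *_) (shiftedCoeff-≥ G (toℕ i) k (ℕP.≤-trans (beyond g f i) N≤k)))
                                         (ℤP.*-zeroʳ (y (deg g ↑ʳ i)))) ⟩
    + 0 + + 0 ≡⟨⟩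
    + 0 ∎
    where
    beyond : ∀ h h′ (i : Fin (deg h′)) → length (coeffs h) ℕ.+ toℕ i ≤ deg h ℕ.+ deg h′
    beyond h h′ i = ℕP.≤-trans (ℕP.≤-reflexive (trans (cong (ℕ._+ toℕ i) (length-coeffs h)) (sym (ℕP.+-suc (deg h) (toℕ i)))))
                               (ℕP.+-monoʳ-≤ (deg h) (FinP.toℕ<n i))

  toℕ-or-≥ : ∀ {n} k → (∃ λ (j : Fin n) → toℕ j ≡ k) ⊎ n ≤ k
  toℕ-or-≥ {n} k with k ℕ.<? n
  ... | yes k<n = inj₁ (fromℕ< k<n , FinP.toℕ-fromℕ< k<n)
  ... | no  k≮n = inj₂ (ℕP.≮⇒≥ k≮n)

  sylvesterPoly-≋ : ∀ y p → length p ≤ N → (∀ j → rowComb y (sylvester f g) j ≡ coeff p (toℕ j)) →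
    sylvesterPoly y ≋ p
  sylvesterPoly-≋ y p p≤N rows = mk≋ λ k → [ (λ { (j , refl) → trans (coeff-sylvesterPoly y j) (rows j) })
                                             , (λ N≤k → trans (coeff-sylvesterPoly-≥ y k N≤k)
                                                              (sym (coeff-≥length p k (ℕP.≤-trans p≤N N≤k)))) ]′
                                             (toℕ-or-≥ k)

  cofactor-rowComb : ∀ {n} (M : Matrix n) → ∃ λ y → ∀ j → rowComb y M j ≡ coeff (C (det M)) (toℕ j)
  cofactor-rowComb {zero}  M = (λ ()) , λ ()
  cofactor-rowComb {suc n} M = cofactor M , λ
    { zero    → rowComb-cofactor-zero M
    ; (suc j) → rowComb-cofactor-suc M j }

  resultant-combination : ∃ λ y → sylvesterPoly y ≋ C (Res f g)
  resultant-combination with cofactor-rowComb (sylvester f g)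
  ... | y , rows = y , sylvesterPoly-≋ y (C (Res f g)) (ℕP.≤-trans (deg≥1 g) (ℕP.m≤m+n (deg g) (deg f))) rows

module Ideal (f g : ZPoly⁺) where

  open import Data.Empty using (⊥-elim)
  open import Data.Integer as ℤ using (ℤ; +_; -[1+_]; _+_; _*_; -_; ∣_∣)
  import Data.Integer.Properties as ℤP
  open import Data.Nat as ℕ using (ℕ; zero; suc; s≤s; z≤n)
  import Data.Nat.Properties as ℕP
  open import Data.Nat.DivMod using (_/_; _%_; m≡m%n+[m/n]*n; m%n<n)
  open import Data.Nat.Divisibility using (_∣_; m%n≡0⇒n∣m)
  open import Data.Product using (∃₂; _,_)
  open import Relation.Binary.PropositionalEquality
  open import Data.Integer.Tactic.RingSolver using (solve-∀)

  open IntegerPolynomial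
  open Sylvester f g using (F; G; fFactor; gFactor; resultant-combination)

  Combination : ℤ → Set
  Combination c = ∃₂ λ P Q → P *ₚ F +ₚ Q *ₚ G ≋ C c

  fromInIdeal : ∀ {n} → InIdeal f g n → Combination (+ n)
  fromInIdeal (P , Q , e) = P , Q , mk≋ e

  toInIdeal : ∀ {n} → Combination (+ n) → InIdeal f g n
  toInIdeal (P , Q , e) = P , Q , coeffwise e

  lincomb-≋ : ∀ {P₁ Q₁ P₂ Q₂ s t} → P₁ *ₚ F +ₚ Q₁ *ₚ G ≋ C s → P₂ *ₚ F +ₚ Q₂ *ₚ G ≋ C t → ∀ a b →
    (C a *ₚ P₁ +ₚ C b *ₚ P₂) *ₚ F +ₚ (C a *ₚ Q₁ +ₚ C b *ₚ Q₂) *ₚ G ≋ C (a * s + b * t)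
  lincomb-≋ {P₁} {Q₁} {P₂} {Q₂} {s} {t} e₁ e₂ a b =
    ≋-trans (combination-identity (C a) (C b) P₁ Q₁ P₂ Q₂ F G)
      (≋-trans (+ₚ-cong (*ₚ-congˡ (C a) e₁) (*ₚ-congˡ (C b) e₂)) constants)
    where
    constants : C a *ₚ C s +ₚ C b *ₚ C t ≋ C (a * s + b * t)
    constants = mk≋ λ { zero → cong₂ _+_ (ℤP.+-identityʳ (a * s)) (ℤP.+-identityʳ (b * t)) ; (suc k) → refl }

  combination-lincomb : ∀ {s t} → Combination s → Combination t → ∀ a b → Combination (a * s + b * t)
  combination-lincomb (P₁ , Q₁ , e₁) (P₂ , Q₂ , e₂) a b =
    C a *ₚ P₁ +ₚ C b *ₚ P₂ , C a *ₚ Q₁ +ₚ C b *ₚ Q₂ , lincomb-≋ {P₁} {Q₁} {P₂} {Q₂} e₁ e₂ a b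

  combination-Res : Combination (Res f g)
  combination-Res with resultant-combination
  ... | y , e = fFactor y , gFactor y , e

  InIdeal-∣∣ : ∀ {c} → Combination c → InIdeal f g ∣ c ∣
  InIdeal-∣∣ {+ n}      rep = toInIdeal rep
  InIdeal-∣∣ { -[1+ n ]} rep = toInIdeal (subst Combination (lemma -[1+ n ]) (combination-lincomb rep rep (- + 1) (+ 0)))
    where
    lemma : ∀ c → - + 1 * c + + 0 * c ≡ - c
    lemma = solve-∀

  InIdeal-R : InIdeal f g (R f g)
  InIdeal-R = InIdeal-∣∣ combination-Res

  -- The remainder of s modulo r is again in the ideal, so minimality of r forces it to vanish.
  IsR⇒∣ : ∀ {r s} → IsR f g r → InIdeal f g s → r ∣ s
  IsR⇒∣ {suc r-1} {s} (_ , r∈ , r-least) s∈ = m%n≡0⇒n∣m s r (remainder≡0 (s % r) refl)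
    where
    r = suc r-1
    q = s / r
    remainder : + s + (- + q) * + r ≡ + (s % r)
    remainder = begin
      + s + (- + q) * + r                      ≡⟨ cong (λ x → + x + (- + q) * + r) (m≡m%n+[m/n]*n s r) ⟩
      + (s % r ℕ.+ q ℕ.* r) + (- + q) * + r    ≡⟨ cong (λ x → x + (- + q) * + r) (ℤP.pos-+ (s % r) (q ℕ.* r)) ⟩
      + (s % r) + + (q ℕ.* r) + (- + q) * + r  ≡⟨ cong (λ x → + (s % r) + x + (- + q) * + r) (ℤP.pos-* q r) ⟩
      + (s % r) + + q * + r + (- + q) * + r    ≡⟨ lemma (+ (s % r)) (+ q) (+ r) ⟩
      + (s % r)                                ∎
      where
      open ≡-Reasoning
      lemma : ∀ t q r → t + q * r + (- q) * r ≡ t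
      lemma = solve-∀
    remainder∈ : InIdeal f g (s % r)
    remainder∈ = toInIdeal (subst Combination (trans (cong (_+ (- + q) * + r) (ℤP.*-identityˡ (+ s))) remainder)
      (combination-lincomb (fromInIdeal s∈) (fromInIdeal r∈) (+ 1) (- + q)))
    remainder≡0 : ∀ t → t ≡ s % r → s % r ≡ 0
    remainder≡0 zero    t≡ = sym t≡
    remainder≡0 (suc t) t≡ = ⊥-elim (ℕP.<⇒≱ (m%n<n s r) (r-least (s % r) (subst (1 ℕ.≤_) t≡ (s≤s z≤n)) remainder∈))

module Denominators where

  open import Data.Empty using (⊥-elim)
  open import Data.Integer as ℤ using (ℤ; +_; _+_; _*_; ∣_∣)
  import Data.Integer.Properties as ℤP
  open import Data.List using (List; []; _∷_; map; length)
  open import Data.List.Relation.Unary.All as All using (All; []; _∷_)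
  open import Data.Nat as ℕ using (ℕ; zero; suc)
  import Data.Nat.Properties as ℕP
  open import Data.Nat.Coprimality as Coprime using (coprime-divisor)
  open import Data.Nat.Divisibility using (_∣_; divides; ∣-trans; 1∣_)
  open import Data.Nat.GCD using (gcd)
  open import Data.Nat.LCM using (m∣lcm[m,n]; n∣lcm[m,n]; lcm-least; gcd*lcm)
  open import Data.Rational as ℚ using (ℚ; mkℚ)
  import Data.Rational.Properties as ℚP
  open import Data.Rational.Unnormalised as ℚᵘ using (mkℚᵘ; *≡*)
  import Data.Rational.Unnormalised.Properties as ℚᵘP
  open import Data.Sum using ([_,_]′)
  open import Relation.Binary.PropositionalEquality
  open import Data.Integer.Tactic.RingSolver using (solve-∀)

  module ℚ[x] = Polynomial ℚ.+-*-rawRing ℚP.+-*-isCommutativeRing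
  open IntegerPolynomial using (_+ₚ_; _*ₚ_)

  private
    toℚᵘ-toℚ : ∀ z → ℚ.toℚᵘ (toℚ z) ℚᵘ.≃ mkℚᵘ z 0
    toℚᵘ-toℚ z = ℚP.toℚᵘ-fromℚᵘ (mkℚᵘ z 0)

  toℚ-+ : ∀ a b → toℚ (a + b) ≡ toℚ a ℚ.+ toℚ b
  toℚ-+ a b = ℚP.toℚᵘ-injective (ℚᵘP.≃-trans (toℚᵘ-toℚ (a + b)) (ℚᵘP.≃-sym
    (ℚᵘP.≃-trans (ℚP.toℚᵘ-homo-+ (toℚ a) (toℚ b))
      (ℚᵘP.≃-trans (ℚᵘP.+-cong (toℚᵘ-toℚ a) (toℚᵘ-toℚ b)) (*≡* (lemma a b))))))
    where
    lemma : ∀ a b → (a * + 1 + b * + 1) * + 1 ≡ (a + b) * + 1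
    lemma = solve-∀

  toℚ-* : ∀ a b → toℚ (a * b) ≡ toℚ a ℚ.* toℚ b
  toℚ-* a b = ℚP.toℚᵘ-injective (ℚᵘP.≃-trans (toℚᵘ-toℚ (a * b)) (ℚᵘP.≃-sym
    (ℚᵘP.≃-trans (ℚP.toℚᵘ-homo-* (toℚ a) (toℚ b))
      (ℚᵘP.≃-trans (ℚᵘP.*-cong (toℚᵘ-toℚ a) (toℚᵘ-toℚ b)) (*≡* refl)))))

  toℚ-injective : ∀ {a b} → toℚ a ≡ toℚ b → a ≡ b
  toℚ-injective {a} {b} e with ℚᵘP.≃-trans (ℚᵘP.≃-sym (toℚᵘ-toℚ a)) (ℚᵘP.≃-trans (ℚP.toℚᵘ-cong e) (toℚᵘ-toℚ b))
  ... | *≡* e′ = trans (sym (ℤP.*-identityʳ a)) (trans e′ (ℤP.*-identityʳ b))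

  map-toℚ-+ₚ : ∀ p q → map toℚ (p +ₚ q) ≡ map toℚ p ℚ[x].+ₚ map toℚ q
  map-toℚ-+ₚ []      q       = refl
  map-toℚ-+ₚ (a ∷ p) []      = refl
  map-toℚ-+ₚ (a ∷ p) (b ∷ q) = cong₂ _∷_ (toℚ-+ a b) (map-toℚ-+ₚ p q)

  map-toℚ-*ₚ : ∀ p q → map toℚ (p *ₚ q) ≡ map toℚ p ℚ[x].*ₚ map toℚ q
  map-toℚ-*ₚ []      q = refl
  map-toℚ-*ₚ (a ∷ p) q = trans (map-toℚ-+ₚ (map (a *_) q) (+ 0 ∷ p *ₚ q))
    (cong₂ ℚ[x]._+ₚ_ (scale q) (cong (ℚ.0ℚ ∷_) (map-toℚ-*ₚ p q)))
    where
    scale : ∀ q → map toℚ (map (a *_) q) ≡ toℚ a ℚ[x].·ₚ map toℚ q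
    scale []      = refl
    scale (b ∷ q) = cong₂ _∷_ (toℚ-* a b) (scale q)

  den : ℚ → ℕ
  den = ℚ.denominatorℕ

  den∣lcmDen : ∀ xs → All (λ x → den x ∣ lcmDen xs) xs
  den∣lcmDen []       = []
  den∣lcmDen (x ∷ xs) = m∣lcm[m,n] (den x) (lcmDen xs)
                      ∷ All.map (λ d∣ → ∣-trans d∣ (n∣lcm[m,n] (den x) (lcmDen xs))) (den∣lcmDen xs)

  lcmDen-least : ∀ {c} xs → All (λ x → den x ∣ c) xs → lcmDen xs ∣ c
  lcmDen-least []       []           = 1∣ _
  lcmDen-least (x ∷ xs) (d∣ ∷ ds∣) = lcm-least d∣ (lcmDen-least xs ds∣)

  lcmDen≢0 : ∀ xs → lcmDen xs ≢ 0
  lcmDen≢0 []       ()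
  lcmDen≢0 (x ∷ xs) lcm≡0 = [ (λ ()) , lcmDen≢0 xs ]′ (ℕP.m*n≡0⇒m≡0∨n≡0 (den x) (begin
    den x ℕ.* lcmDen xs                        ≡⟨ gcd*lcm (den x) (lcmDen xs) ⟨
    gcd (den x) (lcmDen xs) ℕ.* lcmDen (x ∷ xs) ≡⟨ cong (gcd (den x) (lcmDen xs) ℕ.*_) lcm≡0 ⟩
    gcd (den x) (lcmDen xs) ℕ.* 0               ≡⟨ ℕP.*-zeroʳ (gcd (den x) (lcmDen xs)) ⟩
    0                                           ∎))
    where open ≡-Reasoning

  -- The integer list D xs, for a common multiple D of the denominators.
  clear : ∀ D (xs : List ℚ) → All (λ x → den x ∣ D) xs → List ℤ
  clear D []       []                = []
  clear D (x ∷ xs) (divides q _ ∷ ds) = ℚ.numerator x * + q ∷ clear D xs ds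

  length-clear : ∀ D xs ds → length (clear D xs ds) ≡ length xs
  length-clear D []       []                = refl
  length-clear D (x ∷ xs) (divides q _ ∷ ds) = cong suc (length-clear D xs ds)

  map-toℚ-clear : ∀ D xs ds → map toℚ (clear D xs ds) ≡ toℚ (+ D) ℚ[x].·ₚ xs
  map-toℚ-clear D []                   []                  = refl
  map-toℚ-clear D (x@(mkℚ n d-1 _) ∷ xs) (divides q D≡ ∷ ds) =
    cong₂ _∷_ (ℚP.toℚᵘ-injective (ℚᵘP.≃-sym (ℚᵘP.≃-trans (ℚP.toℚᵘ-homo-* (toℚ (+ D)) x)
      (ℚᵘP.≃-trans (ℚᵘP.*-cong (toℚᵘ-toℚ (+ D)) (ℚᵘP.≃-refl {mkℚᵘ n d-1}))
        (ℚᵘP.≃-trans (*≡* cross) (ℚᵘP.≃-sym (toℚᵘ-toℚ (n * + q))))))))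
      (map-toℚ-clear D xs ds)
    where
    cross : (+ D * n) * + 1 ≡ (n * + q) * + (1 ℕ.* suc d-1)
    cross = trans (cong (λ w → (+ w * n) * + 1) D≡) (trans (cong (λ w → (w * n) * + 1) (ℤP.pos-* q (suc d-1)))
      (trans (lemma (+ q) (+ suc d-1) n) (cong (λ w → (n * + q) * + w) (sym (ℕP.*-identityˡ (suc d-1))))))
      where
      lemma : ∀ a b n → (a * b * n) * + 1 ≡ (n * a) * b
      lemma = solve-∀

  -- Cancelling D leaves c x integral for every x in xs, and numerators are coprime to
  -- denominators.
  den∣-clear : ∀ c D (xs : List ℚ) (ds : All (λ x → den x ∣ D) xs) (w : List ℤ) → D ≢ 0 →
    (∀ k → c * IntegerPolynomial.coeff (clear D xs ds) k ≡ + D * IntegerPolynomial.coeff w k) →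
    All (λ x → den x ∣ ∣ c ∣) xs
  den∣-clear c D []       []                 w D≢0 h = []
  den∣-clear c D (x ∷ xs) (divides zero D≡ ∷ ds) w D≢0 h = ⊥-elim (D≢0 D≡)
  den∣-clear c D (x@(mkℚ n d-1 coprime) ∷ xs) (divides q@(suc _) D≡ ∷ ds) w D≢0 h =
    head∣ ∷ den∣-clear c D xs ds (tail w) D≢0 (λ k → trans (h (suc k)) (cong (+ D *_) (coeff-tail w k)))
    where
    open IntegerPolynomial using (coeff)
    tail : List ℤ → List ℤ
    tail []      = []
    tail (_ ∷ w) = w
    coeff-tail : ∀ w k → coeff w (suc k) ≡ coeff (tail w) k
    coeff-tail []      k = refl
    coeff-tail (_ ∷ w) k = refl
    d = suc d-1
    w₀ = coeff w 0
    scaled : (c * n) * + q ≡ (+ d * w₀) * + q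
    scaled = trans (lemma₁ c n (+ q)) (trans (h 0) (trans (cong (λ v → + v * w₀) D≡)
               (trans (cong (_* w₀) (ℤP.pos-* q d)) (lemma₂ (+ q) (+ d) w₀))))
      where
      lemma₁ : ∀ a b c → (a * b) * c ≡ a * (b * c)
      lemma₁ = solve-∀
      lemma₂ : ∀ a b c → a * b * c ≡ (b * c) * a
      lemma₂ = solve-∀
    integral : ∣ n ∣ ℕ.* ∣ c ∣ ≡ d ℕ.* ∣ w₀ ∣
    integral = trans (ℕP.*-comm ∣ n ∣ ∣ c ∣) (trans (sym (ℤP.abs-* c n))
      (trans (cong ∣_∣ (ℤP.*-cancelʳ-≡ (c * n) (+ d * w₀) (+ q) scaled)) (ℤP.abs-* (+ d) w₀)))
    head∣ : d ∣ ∣ c ∣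
    head∣ = coprime-divisor (Coprime.sym (Coprime.recompute coprime)) (divides ∣ w₀ ∣ (trans integral (ℕP.*-comm d ∣ w₀ ∣)))

  coeff-map-toℚ : ∀ a k → ℚ[x].coeff (map toℚ a) k ≡ toℚ (IntegerPolynomial.coeff a k)
  coeff-map-toℚ []      k       = refl
  coeff-map-toℚ (x ∷ a) zero    = refl
  coeff-map-toℚ (x ∷ a) (suc k) = coeff-map-toℚ a k

module RationalBezout (f g : ZPoly⁺) (p q : List ℚ) (bezout : IsBezoutℚ f g p q) where

  import Data.Fin as Fin
  open import Function using (_∘_)
  open import Data.Integer as ℤ using (ℤ; +_; _+_; _*_; -_)
  import Data.Integer.Properties as ℤP
  open import Data.List using ([]; _∷_; map; _++_)
  open import Data.List.Relation.Unary.All using (All)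
  open import Data.List.Relation.Unary.All.Properties using (++⁺; ++⁻)
  open import Data.Nat as ℕ using (ℕ; zero; suc; _≤_)
  import Data.Nat.Properties as ℕP
  open import Data.Nat.Divisibility using (_∣_)
  import Data.Rational as ℚ
  import Data.Rational.Properties as ℚP
  open import Data.Product using (_×_; _,_; proj₁; proj₂)
  open import Relation.Binary.PropositionalEquality
  open import Data.Integer.Tactic.RingSolver using (solve-∀)

  open IntegerPolynomial
  open Denominators
  open Ideal f g
  open Sylvester f g using (F; G; fFactor; gFactor; resultant-combination)
  open ≡-Reasoning

  D : ℕ
  D = B p q

  dens-p : All (λ x → den x ∣ D) p
  dens-p = proj₁ (++⁻ p (den∣lcmDen (p ++ q)))

  dens-q : All (λ x → den x ∣ D) q
  dens-q = proj₂ (++⁻ p (den∣lcmDen (p ++ q)))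

  P Q : List ℤ
  P = clear D p dens-p
  Q = clear D q dens-q

  cleared-bezout : P *ₚ F +ₚ Q *ₚ G ≋ C (+ D)
  cleared-bezout = mk≋ λ k → toℚ-injective (begin
    toℚ (coeff (P *ₚ F +ₚ Q *ₚ G) k)
      ≡⟨ coeff-map-toℚ (P *ₚ F +ₚ Q *ₚ G) k ⟨
    ℚ[x].coeff (map toℚ (P *ₚ F +ₚ Q *ₚ G)) k
      ≡⟨ cong (λ w → ℚ[x].coeff w k) (trans (map-toℚ-+ₚ (P *ₚ F) (Q *ₚ G))
           (cong₂ ℚ[x]._+ₚ_ (trans (map-toℚ-*ₚ P F) (cong (ℚ[x]._*ₚ coeffsℚ f) (map-toℚ-clear D p dens-p)))
                            (trans (map-toℚ-*ₚ Q G) (cong (ℚ[x]._*ₚ coeffsℚ g) (map-toℚ-clear D q dens-q))))) ⟩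
    ℚ[x].coeff ((d ℚ[x].·ₚ p) ℚ[x].*ₚ coeffsℚ f ℚ[x].+ₚ (d ℚ[x].·ₚ q) ℚ[x].*ₚ coeffsℚ g) k
      ≡⟨ ℚ[x].coeff-+ₚ ((d ℚ[x].·ₚ p) ℚ[x].*ₚ coeffsℚ f) _ k ⟩
    ℚ[x].coeff ((d ℚ[x].·ₚ p) ℚ[x].*ₚ coeffsℚ f) k ℚ.+ ℚ[x].coeff ((d ℚ[x].·ₚ q) ℚ[x].*ₚ coeffsℚ g) k
      ≡⟨ cong₂ ℚ._+_ (scaled p (coeffsℚ f) k) (scaled q (coeffsℚ g) k) ⟩
    d ℚ.* ℚ[x].coeff (p ℚ[x].*ₚ coeffsℚ f) k ℚ.+ d ℚ.* ℚ[x].coeff (q ℚ[x].*ₚ coeffsℚ g) k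
      ≡⟨ ℚP.*-distribˡ-+ d _ _ ⟨
    d ℚ.* (ℚ[x].coeff (p ℚ[x].*ₚ coeffsℚ f) k ℚ.+ ℚ[x].coeff (q ℚ[x].*ₚ coeffsℚ g) k)
      ≡⟨ cong (d ℚ.*_) (trans (sym (ℚ[x].coeff-+ₚ (p ℚ[x].*ₚ coeffsℚ f) _ k)) (proj₂ (proj₂ bezout) k)) ⟩
    d ℚ.* ℚ[x].coeff (ℚ.1ℚ ∷ []) k
      ≡⟨ constant k ⟩
    toℚ (coeff (C (+ D)) k) ∎)
    where
    d = toℚ (+ D)
    scaled : ∀ xs H k → ℚ[x].coeff ((d ℚ[x].·ₚ xs) ℚ[x].*ₚ H) k ≡ d ℚ.* ℚ[x].coeff (xs ℚ[x].*ₚ H) k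
    scaled xs H k = trans (ℚ[x].coeffwise (ℚ[x].·ₚ-*ₚ d xs H) k) (ℚ[x].coeff-·ₚ d (xs ℚ[x].*ₚ H) k)
    constant : ∀ k → d ℚ.* ℚ[x].coeff (ℚ.1ℚ ∷ []) k ≡ toℚ (coeff (C (+ D)) k)
    constant zero    = ℚP.*-identityʳ d
    constant (suc k) = ℚP.*-zeroʳ d

  r∣B : ∀ {r} → IsR f g r → r ∣ D
  r∣B isR = IsR⇒∣ isR (toInIdeal (P , Q , cleared-bezout))

  -- With Res = y·S written as W₁ f + W₂ g, the pair (Res·P - B·W₁, Res·Q - B·W₂) is a
  -- syzygy of (f, g) of low degree, hence zero: Res·(B p) = B·W₁, so Res p is integral.
  B∣R : ∀ {r} → IsR f g r → D ∣ R f g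
  B∣R {r} (1≤r , (Pᵣ , Qᵣ , r-rep) , _) with resultant-combination
  ... | y , res-rep = lcmDen-least (p ++ q)
    (++⁺ (den∣-clear dt D p dens-p W₁ D≢0 (cancel P W₁ (proj₁ U,V-vanish)))
         (den∣-clear dt D q dens-q W₂ D≢0 (cancel Q W₂ (proj₂ U,V-vanish))))
    where
    open PrimeIdeal.Modulo PrimeIdeal.≡0-isDecPrimeIdeal using (Vanishes; coeffs-HasDegree; syzygy-vanishes)
    dt = Res f g
    W₁ = fFactor y
    W₂ = gFactor y
    D≢0 : D ≢ 0
    D≢0 = lcmDen≢0 (p ++ q)
    combine : List ℤ → List ℤ → List ℤ
    combine X W = C dt *ₚ X +ₚ C (- + D) *ₚ W
    coeff-combine : ∀ X W k → coeff (combine X W) k ≡ dt * coeff X k + (- + D) * coeff W k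
    coeff-combine X W k = trans (coeff-+ₚ (C dt *ₚ X) _ k) (cong₂ _+_ (coeff-C*ₚ dt X k) (coeff-C*ₚ (- + D) W k))
    cancel : ∀ X W → Vanishes (combine X W) → ∀ k → dt * coeff X k ≡ + D * coeff W k
    cancel X W vanishes k = begin
      dt * coeff X k
        ≡⟨ lemma (dt * coeff X k) (+ D) (coeff W k) ⟩
      (dt * coeff X k + (- + D) * coeff W k) + + D * coeff W k
        ≡⟨ cong (_+ + D * coeff W k) (trans (sym (coeff-combine X W k)) (vanishes k)) ⟩
      + 0 + + D * coeff W k
        ≡⟨ ℤP.+-identityˡ _ ⟩
      + D * coeff W k ∎
      where
      lemma : ∀ x d w → x ≡ (x + (- d) * w) + d * w
      lemma = solve-∀
    syzygy : Vanishes (combine P W₁ *ₚ F +ₚ combine Q W₂ *ₚ G)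
    syzygy k = trans (coeffwise (lincomb-≋ {P} {Q} {W₁} {W₂} cleared-bezout res-rep dt (- + D)) k) (constant k)
      where
      constant : ∀ k → coeff (C (dt * + D + (- + D) * dt)) k ≡ + 0
      constant zero    = lemma dt (+ D)
        where
        lemma : ∀ a b → a * b + (- b) * a ≡ + 0
        lemma = solve-∀
      constant (suc k) = refl
    P-high : ∀ k → deg g ≤ k → coeff (combine P W₁) k ≡ + 0
    P-high k deg≤k = trans (coeff-combine P W₁ k) (trans (cong₂ (λ x w → dt * x + (- + D) * w)
        (coeff-≥length P k (subst (_≤ k) (sym (trans (length-clear D p dens-p) (proj₁ bezout))) deg≤k))
        (coeff-tabulate-≥ (y ∘ (Fin._↑ˡ deg f)) k deg≤k))
      (cong₂ _+_ (ℤP.*-zeroʳ dt) (ℤP.*-zeroʳ (- + D))))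
    U,V-vanish : Vanishes (combine P W₁) × Vanishes (combine Q W₂)
    U,V-vanish = syzygy-vanishes {F} {G} {Pᵣ} {Qᵣ} {combine P W₁} {combine Q W₂} (coeffs-HasDegree g (lead≢0 g)) (mk≋ r-rep)
                   (r≢0 1≤r) P-high syzygy
      where
      r≢0 : ∀ {r} → 1 ≤ r → + r ≢ + 0
      r≢0 (ℕ.s≤s _) ()

module ResultantModulo (f g : ZPoly⁺) {𝔭 : ℤ → Set} (isDecPrimeIdeal : PrimeIdeal.IsDecPrimeIdeal 𝔭) where

  open import Data.Empty using (⊥-elim)
  open import Data.Fin using (Fin; toℕ; splitAt; join)
  open import Data.Fin.Properties using (join-splitAt)
  open import Data.Integer using (+_)
  open import Data.List using (tabulate)
  open import Data.Nat using (_≤_)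
  open import Data.Product using (_,_; swap)
  open import Data.Sum using (_⊎_; inj₁; inj₂; [_,_]′)
  open import Function using (_∘_)
  open import Relation.Binary.PropositionalEquality using (refl; sym; subst)
  open import Relation.Nullary using (yes; no; ¬_)

  open IntegerPolynomial
  open PrimeIdeal.Modulo isDecPrimeIdeal
  open Kernel isDecPrimeIdeal
  open Sylvester f g
  open Ideal f g using (Combination)

  Res∈⇒∈ : ¬ 𝔭 (lead f) ⊎ ¬ 𝔭 (lead g) → ∀ {r} → Combination r → 𝔭 (Res f g) → 𝔭 r
  Res∈⇒∈ lead∉ {r} (P , Q , rep) Res∈ with r ∈?
  ... | yes r∈ = r∈
  ... | no  r∉ with singular⇒kernel (sylvester f g) Res∈
  ...   | y , (r₀ , y∉) , y∈ = ⊥-elim (y∉ (entries∈ (factors-vanish lead∉) r₀))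
    where
    poly-vanishes : Vanishes (sylvesterPoly y)
    poly-vanishes k = [ (λ { (j , refl) → subst 𝔭 (sym (coeff-sylvesterPoly y j)) (y∈ j) })
                      , (λ N≤k → subst 𝔭 (sym (coeff-sylvesterPoly-≥ y k N≤k)) 0∈) ]′ (toℕ-or-≥ k)
    high : ∀ {n} (v : Fin n → ℤ) k → n ≤ k → 𝔭 (coeff (tabulate v) k)
    high v k n≤k = subst 𝔭 (sym (coeff-tabulate-≥ v k n≤k)) 0∈
    factors-vanish : ¬ 𝔭 (lead f) ⊎ ¬ 𝔭 (lead g) → Vanishes (fFactor y) × Vanishes (gFactor y)
    factors-vanish (inj₂ g∉) = syzygy-vanishes {F} {G} {P} {Q} {fFactor y} {gFactor y}
      (coeffs-HasDegree g g∉) rep r∉ (high _) poly-vanishes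
    factors-vanish (inj₁ f∉) = swap (syzygy-vanishes {G} {F} {Q} {P} {gFactor y} {fFactor y}
      (coeffs-HasDegree f f∉) (≋-trans (+ₚ-comm (Q *ₚ G) (P *ₚ F)) rep) r∉ (high _)
      (Vanishes-cong (+ₚ-comm (fFactor y *ₚ F) (gFactor y *ₚ G)) poly-vanishes))
    entries∈ : Vanishes (fFactor y) × Vanishes (gFactor y) → ∀ i → 𝔭 (y i)
    entries∈ (f-vanishes , g-vanishes) i = subst (𝔭 ∘ y) (join-splitAt (deg g) (deg f) i) (by-part (splitAt (deg g) i))
      where
      by-part : ∀ s → 𝔭 (y (join (deg g) (deg f) s))
      by-part (inj₁ i) = subst 𝔭 (coeff-tabulate _ i) (f-vanishes (toℕ i))
      by-part (inj₂ i) = subst 𝔭 (coeff-tabulate _ i) (g-vanishes (toℕ i))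

prime∣R⇒prime∣r : ∀ {ℓ r} (f g : ZPoly⁺) → Prime ℓ → gcd ∣ L f ∣ ∣ L g ∣ ≡ 1 → InIdeal f g r → ℓ ∣ R f g → ℓ ∣ r
prime∣R⇒prime∣r {ℓ} f g ℓ-prime gcd≡1 r∈ =
  ResultantModulo.Res∈⇒∈ f g isDecPrimeIdeal lead∉ (Ideal.fromInIdeal f g r∈)
  where
  isDecPrimeIdeal = PrimeIdeal.∣∣-isDecPrimeIdeal ℓ-prime
  lead∉ : ¬ (ℓ ∣ ∣ lead f ∣) ⊎ ¬ (ℓ ∣ ∣ lead g ∣)
  lead∉ with ℓ ∣? ∣ lead f ∣
  ... | no  ℓ∤f = inj₁ ℓ∤f
  ... | yes ℓ∣f = inj₂ λ ℓ∣g →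
    PrimeIdeal.IsDecPrimeIdeal.1∉ isDecPrimeIdeal (subst (ℓ ∣_) gcd≡1 (gcd-greatest ℓ∣f ℓ∣g))

corollary5p8 : (f g : ZPoly⁺) → CoprimeInℚ[x] f g → gcd ∣ L f ∣ ∣ L g ∣ ≡ 1 →
    (p q : List ℚ) → IsBezoutℚ f g p q → (r : ℕ) → IsR f g r →
    (ℓ : ℕ) → Prime ℓ → ((ℓ ∣ B p q) ⇔ (ℓ ∣ r)) × ((ℓ ∣ r) ⇔ (ℓ ∣ R f g))
corollary5p8 f g _ gcd≡1 p q bezout r isR ℓ ℓ-prime =
  mk⇔ (λ ℓ∣B → ℓ∣R⇒ℓ∣r (∣-trans ℓ∣B (B∣R isR))) (λ ℓ∣r → ∣-trans ℓ∣r (r∣B isR)) ,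
  mk⇔ (λ ℓ∣r → ∣-trans ℓ∣r r∣R) ℓ∣R⇒ℓ∣r
  where
  open RationalBezout f g p q bezout using (r∣B; B∣R)
  ℓ∣R⇒ℓ∣r : ℓ ∣ R f g → ℓ ∣ r
  ℓ∣R⇒ℓ∣r = prime∣R⇒prime∣r f g ℓ-prime gcd≡1 (proj₁ (proj₂ isR))
  r∣R : r ∣ R f g
  r∣R = Ideal.IsR⇒∣ f g isR (Ideal.InIdeal-R f g)
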